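{- Let $q$ be an odd prime and let $p>q$ be a prime such that $q$ is a primitive root modulo $p$. Then $h_q(p)=0$; equivalently, no nonzero vector $v\in\mathbb{F}_q^p$ works.
   Context: For $n\in\mathbb{N}$, let $\sigma:\mathbb{F}_q^n\to\mathbb{F}_q^n$ be the cyclic shift $\sigma(\sum_{i=0}^{n-1}x_ie_i)=\sum_{i=0}^{n-1}x_ie_{i+1}$ (indices mod $n$). A subspace $U\le\mathbb{F}_q^n$ is cyclically covering if $\bigcup_{i=0}^{n-1}\sigma^i(U)=\mathbb{F}_q^n$; $h_q(n)$ is the largest possible codimension of a cyclically covering subspace of $\mathbb{F}_q^n$. A vector $v\in\mathbb{F}_q^n$ works if for every $x\in\mathbb{F}_q^n$ there is $k\in\{0,\dots,n-1\}$ with $v\cdot\sigma^kx=0$. -}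

module Defs where

open import Data.Nat using (ℕ; zero; suc; _+_; _*_; _∸_; _^_; _%_; _<_; NonZero)
open import Data.Nat.DivMod using (_mod_)
open import Data.Nat.Coprimality using (Coprime)
open import Data.Fin using (Fin; toℕ)
open import Data.Vec using (Vec; []; _∷_; last; init; zipWith; map; replicate; sum)
open import Data.Product using (Σ; ∃; _×_)
open import Relation.Binary.PropositionalEquality using (_≡_; _≢_)
open import Function using (_∘_)

record PrimitiveRootMod (p g : ℕ) .{{_ : NonZero p}} : Set where
  field
    coprime   : Coprime g p
    order     : (g ^ (p ∸ 1)) % p ≡ 1 % p
    minimal   : ∀ k → 0 < k → k < p ∸ 1 → (g ^ k) % p ≢ 1 % p

module _ (q : ℕ) .{{_ : NonZero q}} where

  Fq : Set
  Fq = Fin q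

  0F : Fq
  0F = 0 mod q

  _+F_ : Fq → Fq → Fq
  a +F b = (toℕ a + toℕ b) mod q

  _*F_ : Fq → Fq → Fq
  a *F b = (toℕ a * toℕ b) mod q

  Vecq : ℕ → Set
  Vecq n = Vec Fq n

  zeroV : ∀ {n} → Vecq n
  zeroV = replicate _ 0F

  _+V_ : ∀ {n} → Vecq n → Vecq n → Vecq n
  _+V_ = zipWith _+F_

  _·V_ : ∀ {n} → Fq → Vecq n → Vecq n
  c ·V v = map (c *F_) v

  dot : ∀ {n} → Vecq n → Vecq n → Fq
  dot v x = sum (zipWith (λ a b → toℕ a * toℕ b) v x) mod q

  record IsSubspace {n : ℕ} (U : Vecq n → Set) : Set where
    field
      zero∈ : U zeroV
      +∈    : ∀ {u w} → U u → U w → U (u +V w)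
      ·∈    : ∀ c {u} → U u → U (c ·V u)

-- cyclic shift σ(Σ x_i e_i) = Σ x_i e_{i+1} (indices mod n):
-- (σ x)_0 = x_{n-1}, (σ x)_{i+1} = x_i.
σ : ∀ {A : Set} {n} → Vec A n → Vec A n
σ {n = zero}  [] = []
σ {n = suc n} xs = last xs ∷ init xs

σ^ : ∀ {A : Set} {n} → ℕ → Vec A n → Vec A n
σ^ zero    x = x
σ^ (suc k) x = σ (σ^ k x)

module _ (q : ℕ) .{{_ : NonZero q}} where

  CyclicallyCovering : ∀ {n} → (Vecq q n → Set) → Set
  CyclicallyCovering {n} U =
    ∀ (x : Vecq q n) → ∃ λ k → k < n × Σ (Vecq q n) (λ u → U u × σ^ k u ≡ x)

  Works : ∀ {n} → Vecq q n → Set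
  Works {n} v = ∀ (x : Vecq q n) → ∃ λ k → k < n × dot q v (σ^ k x) ≡ 0F q

module Submission where

-- Identify 𝔽_q^p with the group ring 𝔽_q[ℤ/p]; the products v · σᵏx are the
-- coefficients of (reversed v) ⊛ x.  So it suffices to show that every W ≢ 0
-- has a multiple W ⊛ X with no zero coefficient (`nowhereZeroMultiple`).
-- The tool is the Frobenius map: modulo q, fᵠ = φ f where φ substitutes
-- x ↦ xᵠ (binomial theorem and Fermat).  Hence multiples of W stay multiples
-- under φ, and so does the trace Tr f = ∑_{m < p-1} φᵐ f.  As q generates
-- (ℤ/p)ˣ, Tr f has coefficient (p-1) f₀ at 0 and S f - f₀ elsewhere, and for
-- S f ≡ 0 multiplying by a nowhere-zero vector of coordinate sum 0 yields
-- p f₀ times that vector.  Part (1) then follows by Gaussian elimination.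

open import Algebra.Bundles using (CommutativeSemiring)
open import Data.Nat using (ℕ; zero; suc; _<_; _∸_; s≤s; z≤n)
open import Data.Nat.Combinatorics using (_C_; nCn≡1)
open import Data.Nat.Divisibility using (_∣_; quotient; m∣n⇒n≡quotient*m)
open import Data.Product using (∃; _,_)
open import Function using (_∘_)

module FreshmansDream {a ℓ} (S : CommutativeSemiring a ℓ) where
  open import Data.Fin using (Fin; toℕ; inject₁; fromℕ) renaming (zero to fzero; suc to fsuc)
  open import Data.Fin.Properties using (toℕ-inject₁; toℕ-fromℕ; toℕ<n)
  open import Data.Nat.Properties using (n∸n≡0) renaming (*-comm to *ℕ-comm)
  import Relation.Binary.PropositionalEquality as P

  open CommutativeSemiring S
  open import Algebra.Properties.Semiring.Exp semiring using (_^_)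
  open import Algebra.Properties.Monoid.Mult +-monoid using (_×_; ×-assocˡ; ×-congˡ)
  open import Algebra.Properties.CommutativeMonoid.Mult +-commutativeMonoid using (×-distrib-+)
  open import Algebra.Properties.Monoid.Sum +-monoid using (sum; sum-init-last; sum-cong-≋)
  import Algebra.Properties.CommutativeSemiring.Binomial S as Binomial
  open import Relation.Binary.Reasoning.Setoid setoid

  ×-zeroʳ : ∀ n → n × 0# ≈ 0#
  ×-zeroʳ zero    = refl
  ×-zeroʳ (suc n) = trans (+-identityˡ _) (×-zeroʳ n)

  sum-× : ∀ n k (f : Fin n → Carrier) → sum (λ i → k × f i) ≈ k × sum f
  sum-× zero    k f = sym (×-zeroʳ k)
  sum-× (suc n) k f =
    trans (+-congˡ (sum-× n k (f ∘ fsuc))) (sym (×-distrib-+ (f fzero) (sum (f ∘ fsuc)) k))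

  freshmansDream : ∀ q → 0 < q → (∀ k → 0 < k → k < q → q ∣ q C k) →
                   ∀ x y → ∃ λ z → (x + y) ^ q ≈ (x ^ q + y ^ q) + q × z
  freshmansDream (suc r) _ q∣C x y = z , expansion
    where
    q : ℕ
    q = suc r
    term : Fin (suc q) → Carrier
    term = Binomial.binomialTerm x y q
    q∣inner : (i : Fin r) → q ∣ q C suc (toℕ (inject₁ i))
    q∣inner i = q∣C (suc (toℕ (inject₁ i))) (s≤s z≤n)
                    (s≤s (P.subst (_< r) (P.sym (toℕ-inject₁ i)) (toℕ<n i)))
    -- the inner terms are (q C (i+1)) · xⁱ⁺¹ yʳ⁻ⁱ = q · (cᵢ · bᵢ)
    c : Fin r → ℕ
    c i = quotient (q∣inner i)
    b : Fin r → Carrier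
    b i = Binomial.binomial x y q (fsuc (inject₁ i))
    z : Carrier
    z = sum (λ i → c i × b i)
    innerTerm : ∀ i → term (fsuc (inject₁ i)) ≈ q × (c i × b i)
    innerTerm i = trans (×-congˡ (m∣n⇒n≡quotient*m (q∣inner i)))
                  (trans (×-congˡ (*ℕ-comm (c i) q)) (sym (×-assocˡ (b i) q (c i))))
    firstTerm : term fzero ≈ y ^ q
    firstTerm = trans (+-identityʳ _) (*-identityˡ _)
    lastTerm : term (fsuc (fromℕ r)) ≈ x ^ q
    lastTerm rewrite toℕ-fromℕ r | nCn≡1 q | n∸n≡0 r = trans (+-identityʳ _) (*-identityʳ _)
    expansion : (x + y) ^ q ≈ (x ^ q + y ^ q) + q × z
    expansion = begin
      (x + y) ^ q
        ≈⟨ Binomial.theorem q x y ⟩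
      term fzero + sum (term ∘ fsuc)
        ≈⟨ +-congˡ (sum-init-last (term ∘ fsuc)) ⟩
      term fzero + (sum (λ i → term (fsuc (inject₁ i))) + term (fsuc (fromℕ r)))
        ≈⟨ +-cong firstTerm (+-cong (trans (sum-cong-≋ innerTerm) (sum-× r q _)) lastTerm) ⟩
      y ^ q + (q × z + x ^ q)
        ≈⟨ trans (+-congˡ (+-comm _ _)) (trans (sym (+-assoc _ _ _)) (+-congʳ (+-comm _ _))) ⟩
      (x ^ q + y ^ q) + q × z ∎

open import Data.Bool using (true; false; if_then_else_)
open import Data.Empty using (⊥; ⊥-elim)
open import Data.Nat
open import Data.Nat.Combinatorics using (k![n∸k]!∣n!)
open import Data.Nat.Combinatorics.Specification using (nCk≡n!/k![n-k]!)
open import Data.Nat.DivMod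
open import Data.Nat.Divisibility
open import Data.Nat.Primality
open import Data.Nat.Properties
open import Data.Nat.Tactic.RingSolver using (solve-∀)
open import Data.Product using (_×_; proj₁; proj₂)
open import Data.Sum using (_⊎_; inj₁; inj₂)
open import Data.Unit using (tt)
open import Relation.Binary.PropositionalEquality
open import Relation.Binary.Definitions using (tri<; tri≈; tri>)
open import Relation.Nullary using (¬_; ¬?; yes; no)

open import Defs

∑ : ℕ → (ℕ → ℕ) → ℕ
∑ zero    f = 0
∑ (suc n) f = ∑ n f + f n

∑-cong< : ∀ n {f g : ℕ → ℕ} → (∀ i → i < n → f i ≡ g i) → ∑ n f ≡ ∑ n g
∑-cong< zero    f≗g = refl
∑-cong< (suc n) f≗g = cong₂ _+_ (∑-cong< n (λ i i<n → f≗g i (m<n⇒m<1+n i<n))) (f≗g n ≤-refl)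

∑-cong : ∀ n {f g : ℕ → ℕ} → (∀ i → f i ≡ g i) → ∑ n f ≡ ∑ n g
∑-cong n f≗g = ∑-cong< n (λ i _ → f≗g i)

∑-+ : ∀ n (f g : ℕ → ℕ) → ∑ n (λ i → f i + g i) ≡ ∑ n f + ∑ n g
∑-+ zero    f g = refl
∑-+ (suc n) f g rewrite ∑-+ n f g = interchange (∑ n f) (∑ n g) (f n) (g n)
  where
  interchange : ∀ a b c d → a + b + (c + d) ≡ a + c + (b + d)
  interchange = solve-∀

∑-*ˡ : ∀ n c (f : ℕ → ℕ) → c * ∑ n f ≡ ∑ n (λ i → c * f i)
∑-*ˡ zero    c f = *-zeroʳ c
∑-*ˡ (suc n) c f rewrite sym (∑-*ˡ n c f) = *-distribˡ-+ c (∑ n f) (f n)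

∑-*ʳ : ∀ n c (f : ℕ → ℕ) → ∑ n f * c ≡ ∑ n (λ i → f i * c)
∑-*ʳ n c f = trans (*-comm (∑ n f) c) (trans (∑-*ˡ n c f) (∑-cong n (λ i → *-comm c (f i))))

∑-zero : ∀ n (f : ℕ → ℕ) → (∀ i → i < n → f i ≡ 0) → ∑ n f ≡ 0
∑-zero zero    f f≡0 = refl
∑-zero (suc n) f f≡0 = cong₂ _+_ (∑-zero n f (λ i i<n → f≡0 i (m<n⇒m<1+n i<n))) (f≡0 n ≤-refl)

∑-const : ∀ n c → ∑ n (λ _ → c) ≡ n * c
∑-const zero    c = refl
∑-const (suc n) c rewrite ∑-const n c = +-comm (n * c) c

∑-swap : ∀ n m (f : ℕ → ℕ → ℕ) → ∑ n (λ i → ∑ m (f i)) ≡ ∑ m (λ j → ∑ n (λ i → f i j))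
∑-swap zero    m f = sym (∑-zero m _ (λ _ _ → refl))
∑-swap (suc n) m f rewrite ∑-swap n m f = sym (∑-+ m (λ j → ∑ n (λ i → f i j)) (f n))

∑-head : ∀ n (f : ℕ → ℕ) → ∑ (suc n) f ≡ f 0 + ∑ n (λ i → f (suc i))
∑-head zero    f = +-comm 0 (f 0)
∑-head (suc n) f rewrite ∑-head n f = +-assoc (f 0) (∑ n (λ i → f (suc i))) (f (suc n))

δ : ℕ → ℕ → ℕ
δ a b = if a ≡ᵇ b then 1 else 0

δ-refl : ∀ a → δ a a ≡ 1
δ-refl a with a ≡ᵇ a | ≡⇒≡ᵇ a a refl
... | true | _ = refl

δ-≢ : ∀ {a b} → a ≢ b → δ a b ≡ 0
δ-≢ {a} {b} a≢b with a ≡ᵇ b | ≡ᵇ⇒≡ a b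
... | false | _    = refl
... | true  | a≡b = ⊥-elim (a≢b (a≡b tt))

δ-sym : ∀ a b → δ a b ≡ δ b a
δ-sym a b with a ≟ b
... | yes refl = refl
... | no  a≢b  = trans (δ-≢ a≢b) (sym (δ-≢ (a≢b ∘ sym)))

∑-δ-unique : ∀ n (g : ℕ → ℕ) j (F : ℕ → ℕ) i₀ → i₀ < n → g i₀ ≡ j →
             (∀ i → i < n → g i ≡ j → i ≡ i₀) → ∑ n (λ i → δ (g i) j * F i) ≡ F i₀
∑-δ-unique zero    g j F i₀ () _ _
∑-δ-unique (suc n) g j F i₀ i₀<1+n gi₀≡j unique with i₀ ≟ n
... | yes refl = begin
  ∑ i₀ (λ i → δ (g i) j * F i) + δ (g i₀) j * F i₀
    ≡⟨ cong₂ _+_ (∑-zero i₀ _ (λ i i<i₀ → cong (_* F i) (δ-≢ (λ e → <⇒≢ i<i₀ (unique i (m<n⇒m<1+n i<i₀) e)))))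
                 (cong (λ x → δ x j * F i₀) gi₀≡j) ⟩
  0 + δ j j * F i₀
    ≡⟨ cong (_* F i₀) (δ-refl j) ⟩
  1 * F i₀
    ≡⟨ *-identityˡ (F i₀) ⟩
  F i₀ ∎
  where open ≡-Reasoning
... | no i₀≢n = begin
  ∑ n (λ i → δ (g i) j * F i) + δ (g n) j * F n
    ≡⟨ cong₂ _+_ (∑-δ-unique n g j F i₀ (≤∧≢⇒< (≤-pred i₀<1+n) i₀≢n) gi₀≡j (λ i i<n → unique i (m<n⇒m<1+n i<n)))
                 (cong (_* F n) (δ-≢ (λ e → i₀≢n (sym (unique n ≤-refl e))))) ⟩
  F i₀ + 0
    ≡⟨ +-identityʳ (F i₀) ⟩
  F i₀ ∎
  where open ≡-Reasoning

∑-δ-none : ∀ n (g : ℕ → ℕ) j (F : ℕ → ℕ) → (∀ i → i < n → g i ≢ j) → ∑ n (λ i → δ (g i) j * F i) ≡ 0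
∑-δ-none n g j F miss = ∑-zero n _ (λ i i<n → cong (_* F i) (δ-≢ (miss i i<n)))

∑-δˡ : ∀ n j (F : ℕ → ℕ) → j < n → ∑ n (λ i → δ i j * F i) ≡ F j
∑-δˡ n j F j<n = ∑-δ-unique n (λ i → i) j F j j<n refl (λ _ _ i≡j → i≡j)

∑-δʳ : ∀ n j (F : ℕ → ℕ) → j < n → ∑ n (λ i → δ j i * F i) ≡ F j
∑-δʳ n j F j<n = trans (∑-cong n (λ i → cong (_* F i) (δ-sym j i))) (∑-δˡ n j F j<n)

infix 4 _≡_[mod_]
_≡_[mod_] : ℕ → ℕ → (m : ℕ) → .{{NonZero m}} → Set
a ≡ b [mod m ] = a % m ≡ b % m

module _ {m : ℕ} .{{_ : NonZero m}} where

  0%m≡0 : 0 % m ≡ 0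
  0%m≡0 = m<n⇒m%n≡m (>-nonZero⁻¹ m)

  +-mod : ∀ {a b c d} → a ≡ b [mod m ] → c ≡ d [mod m ] → a + c ≡ b + d [mod m ]
  +-mod {a} {b} {c} {d} a≡b c≡d =
    trans (%-distribˡ-+ a c m) (trans (cong₂ (λ x y → (x + y) % m) a≡b c≡d) (sym (%-distribˡ-+ b d m)))

  *-mod : ∀ {a b c d} → a ≡ b [mod m ] → c ≡ d [mod m ] → a * c ≡ b * d [mod m ]
  *-mod {a} {b} {c} {d} a≡b c≡d =
    trans (%-distribˡ-* a c m) (trans (cong₂ (λ x y → (x * y) % m) a≡b c≡d) (sym (%-distribˡ-* b d m)))

  ∑-mod : ∀ n {f g : ℕ → ℕ} → (∀ i → i < n → f i ≡ g i [mod m ]) → ∑ n f ≡ ∑ n g [mod m ]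
  ∑-mod zero    f≡g = refl
  ∑-mod (suc n) f≡g = +-mod (∑-mod n (λ i i<n → f≡g i (m<n⇒m<1+n i<n))) (f≡g n ≤-refl)

  %-mod : ∀ a → a % m ≡ a [mod m ]
  %-mod a = m%n%n≡m%n a m

  mod⇒∣∸ : ∀ {a b} → a ≤ b → a ≡ b [mod m ] → m ∣ b ∸ a
  mod⇒∣∸ {a} {b} a≤b a≡b = divides (b / m ∸ a / m) (begin
    b ∸ a                                     ≡⟨ cong₂ _∸_ (m≡m%n+[m/n]*n b m) (m≡m%n+[m/n]*n a m) ⟩
    (b % m + b / m * m) ∸ (a % m + a / m * m) ≡⟨ cong (λ x → (b % m + b / m * m) ∸ (x + a / m * m)) a≡b ⟩
    (b % m + b / m * m) ∸ (b % m + a / m * m) ≡⟨ [m+n]∸[m+o]≡n∸o (b % m) (b / m * m) (a / m * m) ⟩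
    b / m * m ∸ a / m * m                     ≡⟨ *-distribʳ-∸ m (b / m) (a / m) ⟨
    (b / m ∸ a / m) * m                       ∎)
    where open ≡-Reasoning

  ∣∸⇒mod : ∀ {a b} → a ≤ b → m ∣ b ∸ a → a ≡ b [mod m ]
  ∣∸⇒mod {a} {b} a≤b m∣b∸a = trans (sym (%-remove-+ʳ a m∣b∸a)) (cong (_% m) (m+[n∸m]≡n a≤b))

  ∣⇒mod0 : ∀ {a} → m ∣ a → a ≡ 0 [mod m ]
  ∣⇒mod0 {a} m∣a = trans (n∣m⇒m%n≡0 a m m∣a) (sym 0%m≡0)

  mod0⇒∣ : ∀ {a} → a ≡ 0 [mod m ] → m ∣ a
  mod0⇒∣ {a} a≡0 = m%n≡0⇒n∣m a m (trans a≡0 0%m≡0)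

  %-absorbˡ : ∀ x c → (x % m + c) % m ≡ (x + c) % m
  %-absorbˡ x c = +-mod (%-mod x) refl

  %-absorbʳ : ∀ c x → (c + x % m) % m ≡ (c + x) % m
  %-absorbʳ c x = +-mod {a = c} refl (%-mod x)

  inverse-unique : ∀ {A B C} → A + C ≡ 0 [mod m ] → B + C ≡ 0 [mod m ] → A ≡ B [mod m ]
  inverse-unique {A} {B} {C} A+C≡0 B+C≡0 = begin
    A % m             ≡⟨ cong (_% m) (+-identityʳ A) ⟨
    (A + 0) % m       ≡⟨ +-mod {a = A} refl B+C≡0 ⟨
    (A + (B + C)) % m ≡⟨ cong (_% m) (swap A B C) ⟩
    (B + (A + C)) % m ≡⟨ +-mod {a = B} refl A+C≡0 ⟩
    (B + 0) % m       ≡⟨ cong (_% m) (+-identityʳ B) ⟩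
    B % m             ∎
    where
    open ≡-Reasoning
    swap : ∀ a b c → a + (b + c) ≡ b + (a + c)
    swap = solve-∀

  -- Since (m - 1) y ≡ -y, the congruence x + (m - 1) y ≡ 0 says x ≡ y.
  x+[m-1]y≡0⇒x≡y : ∀ {x y} → x + y * (m ∸ 1) ≡ 0 [mod m ] → x ≡ y [mod m ]
  x+[m-1]y≡0⇒x≡y {x} {y} x+[m-1]y≡0 = begin
    x % m                       ≡⟨ [m+kn]%n≡m%n x y m ⟨
    (x + y * m) % m             ≡⟨ cong (λ n → (x + y * n) % m) (suc-pred m) ⟨
    (x + y * suc (pred m)) % m  ≡⟨ cong (_% m) (peel x y (pred m)) ⟩
    (x + y * pred m + y) % m    ≡⟨ +-mod x+[m-1]y≡0 refl ⟩
    (0 + y) % m                 ∎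
    where
    open ≡-Reasoning
    peel : ∀ x y n → x + y * suc n ≡ x + y * n + y
    peel = solve-∀

  cancel-mod-prime : Prime m → ∀ {x y} → ¬ m ∣ x → 1 ≤ y → x * y ≡ x [mod m ] → y ≡ 1 [mod m ]
  cancel-mod-prime pm {x} {y} m∤x 1≤y xy≡x with euclidsLemma x (y ∸ 1) pm m∣x[y-1]
    where
    x≤xy : x ≤ x * y
    x≤xy = subst (_≤ x * y) (*-identityʳ x) (*-monoʳ-≤ x 1≤y)
    m∣x[y-1] : m ∣ x * (y ∸ 1)
    m∣x[y-1] = subst (m ∣_) (sym (trans (*-distribˡ-∸ x y 1) (cong (x * y ∸_) (*-identityʳ x))))
                     (mod⇒∣∸ x≤xy (sym xy≡x))
  ... | inj₁ m∣x   = ⊥-elim (m∤x m∣x)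
  ... | inj₂ m∣y-1 = sym (∣∸⇒mod 1≤y m∣y-1)

prime≥2 : ∀ {q} → Prime q → 2 ≤ q
prime≥2 {q} pq = nonTrivial⇒n>1 q {{prime⇒nonTrivial pq}}

oddPrime≥3 : ∀ {q} → Prime q → ¬ 2 ∣ q → 3 ≤ q
oddPrime≥3 {0}                 pq _   = ⊥-elim (<⇒≱ (prime≥2 pq) z≤n)
oddPrime≥3 {1}                 pq _   = ⊥-elim (<⇒≱ (prime≥2 pq) (s≤s z≤n))
oddPrime≥3 {2}                 _  2∤2 = ⊥-elim (2∤2 ∣-refl)
oddPrime≥3 {suc (suc (suc _))} _  _   = s≤s (s≤s (s≤s z≤n))

prime∤! : ∀ {q} → Prime q → ∀ m → m < q → ¬ q ∣ m !
prime∤! pq zero    _   q∣1 = <⇒≢ (prime≥2 pq) (sym (∣1⇒≡1 q∣1))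
prime∤! pq (suc m) m<q q∣m! with euclidsLemma (suc m) (m !) pq q∣m!
... | inj₁ q∣m+1 = <⇒≱ m<q (∣⇒≤ q∣m+1)
... | inj₂ q∣m!' = prime∤! pq m (<-trans (n<1+n m) m<q) q∣m!'

-- ... hence it divides every inner binomial coefficient q C k, 0 < k < q,
-- since q C k · (k! (q-k)!) = q! and q divides neither factorial.
prime∣binomial : ∀ {q} → Prime q → ∀ k → 0 < k → k < q → q ∣ q C k
prime∣binomial {q} pq k 0<k k<q with euclidsLemma (q C k) (k ! * (q ∸ k) !) pq q∣product
  where
  instance _ = k !* (q ∸ k) !≢0
  product≡q! : (q C k) * (k ! * (q ∸ k) !) ≡ q !
  product≡q! = trans (cong (_* (k ! * (q ∸ k) !)) (nCk≡n!/k![n-k]! (<⇒≤ k<q))) (m/n*n≡m (k![n∸k]!∣n! (<⇒≤ k<q)))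
  q∣product : q ∣ (q C k) * (k ! * (q ∸ k) !)
  q∣product = subst (q ∣_) (sym product≡q!) (n∣n! q (≤-trans (s≤s z≤n) (prime≥2 pq)))
    where
    n∣n! : ∀ n → 1 ≤ n → n ∣ n !
    n∣n! (suc n) _ = m∣m*n (n !)
... | inj₁ q∣C = q∣C
... | inj₂ q∣k![q-k]! with euclidsLemma (k !) ((q ∸ k) !) pq q∣k![q-k]!
...   | inj₁ q∣k!     = ⊥-elim (prime∤! pq k k<q q∣k!)
...   | inj₂ q∣[q-k]! = ⊥-elim (prime∤! pq (q ∸ k) (∸-monoʳ-< 0<k (<⇒≤ k<q)) q∣[q-k]!)

-- Fermat's little theorem c^q ≡ c (mod q), by induction on c: the freshman's
-- dream in ℕ gives (c + 1)^q ≡ c^q + 1.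
module _ where
  open import Algebra.Definitions.RawSemiring +-*-rawSemiring using () renaming (_^_ to _^ₛ_; _×_ to _×ₛ_)
  open FreshmansDream +-*-commutativeSemiring using (freshmansDream)

  ^ₛ≡^ : ∀ x n → x ^ₛ n ≡ x ^ n
  ^ₛ≡^ x zero    = refl
  ^ₛ≡^ x (suc n) = cong (x *_) (^ₛ≡^ x n)

  ×ₛ≡* : ∀ n x → n ×ₛ x ≡ n * x
  ×ₛ≡* zero    x = refl
  ×ₛ≡* (suc n) x = cong (x +_) (×ₛ≡* n x)

  fermat : ∀ {q} .{{_ : NonZero q}} → Prime q → ∀ c → c ^ q ≡ c [mod q ]
  fermat {suc _} pq zero    = refl
  fermat {q} pq (suc c) with freshmansDream q (>-nonZero⁻¹ q) (prime∣binomial pq) c 1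
  ... | z , dream = begin
    suc c ^ q % q                   ≡⟨ cong (_% q) (trans (cong (_^ q) (+-comm 1 c)) (sym (^ₛ≡^ (c + 1) q))) ⟩
    (c + 1) ^ₛ q % q                ≡⟨ cong (_% q) dream ⟩
    (c ^ₛ q + 1 ^ₛ q + q ×ₛ z) % q  ≡⟨ cong (_% q) (cong₂ _+_ (cong₂ _+_ (^ₛ≡^ c q) (trans (^ₛ≡^ 1 q) (^-zeroˡ q)))
                                                                (trans (×ₛ≡* q z) (*-comm q z))) ⟩
    (c ^ q + 1 + z * q) % q         ≡⟨ [m+kn]%n≡m%n (c ^ q + 1) z q ⟩
    (c ^ q + 1) % q                 ≡⟨ +-mod {a = c ^ q} (fermat pq c) refl ⟩
    (c + 1) % q                     ≡⟨ cong (_% q) (+-comm c 1) ⟩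
    suc c % q                       ∎
    where open ≡-Reasoning

-- An element is a coefficient function f : ℕ → ℕ,
-- read as ∑_{a<p} f a · xᵃ with xᵖ = 1; only the coefficients below p matter,
-- so equality _≈_ compares those.
module GroupRing (p : ℕ) .{{_ : NonZero p}} where
  open import Algebra.Structures using (IsCommutativeMonoid)
  open import Algebra.Structures.Biased using (isCommutativeSemiringˡ)
  open import Relation.Binary.Structures using (IsEquivalence)

  R : Set
  R = ℕ → ℕ

  infix  4 _≈_
  infixl 6 _⊕_
  infixl 7 _⊛_

  _≈_ : R → R → Set
  f ≈ g = ∀ k → k < p → f k ≡ g k

  _⊕_ : R → R → R
  (f ⊕ g) k = f k + g k

  _⊛_ : R → R → R
  (f ⊛ g) k = ∑ p (λ a → ∑ p (λ b → δ ((a + b) % p) k * (f a * g b)))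

  0R : R
  0R _ = 0

  1R : R
  1R k = δ 0 k

  ⊛-cong : ∀ {f f′ g g′} → f ≈ f′ → g ≈ g′ → f ⊛ g ≈ f′ ⊛ g′
  ⊛-cong f≈f′ g≈g′ k _ = ∑-cong< p (λ a a<p → ∑-cong< p (λ b b<p →
    cong (δ ((a + b) % p) k *_) (cong₂ _*_ (f≈f′ a a<p) (g≈g′ b b<p))))

  ⊛-comm : ∀ f g → f ⊛ g ≈ g ⊛ f
  ⊛-comm f g k _ = trans (∑-swap p p _) (∑-cong p (λ b → ∑-cong p (λ a →
    cong₂ _*_ (cong (λ x → δ (x % p) k) (+-comm a b)) (*-comm (f a) (g b)))))

  ⊛-zeroˡ : ∀ f → 0R ⊛ f ≈ 0R
  ⊛-zeroˡ f k _ = ∑-zero p _ (λ a _ → ∑-zero p _ (λ b _ → *-zeroʳ (δ ((a + b) % p) k)))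

  ⊛-distribʳ : ∀ h f g → (f ⊕ g) ⊛ h ≈ f ⊛ h ⊕ g ⊛ h
  ⊛-distribʳ h f g k _ =
    trans (∑-cong p (λ a → trans (∑-cong p (λ b → distrib (δ ((a + b) % p) k) (f a) (g a) (h b))) (∑-+ p _ _)))
          (∑-+ p _ _)
    where
    distrib : ∀ d x y z → d * ((x + y) * z) ≡ d * (x * z) + d * (y * z)
    distrib = solve-∀

  ⊛-identityˡ : ∀ f → 1R ⊛ f ≈ f
  ⊛-identityˡ f k k<p = begin
    ∑ p (λ a → ∑ p (λ b → δ ((a + b) % p) k * (δ 0 a * f b)))  ≡⟨ ∑-swap p p _ ⟩
    ∑ p (λ b → ∑ p (λ a → δ ((a + b) % p) k * (δ 0 a * f b)))  ≡⟨ ∑-cong p (λ b → ∑-cong p (λ a → exchange (δ ((a + b) % p) k) (δ 0 a) (f b))) ⟩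
    ∑ p (λ b → ∑ p (λ a → δ 0 a * (δ ((a + b) % p) k * f b)))  ≡⟨ ∑-cong p (λ b → ∑-δʳ p 0 (λ a → δ ((a + b) % p) k * f b) (>-nonZero⁻¹ p)) ⟩
    ∑ p (λ b → δ (b % p) k * f b)                               ≡⟨ ∑-cong< p (λ b b<p → cong (λ x → δ x k * f b) (m<n⇒m%n≡m b<p)) ⟩
    ∑ p (λ b → δ b k * f b)                                     ≡⟨ ∑-δˡ p k f k<p ⟩
    f k                                                         ∎
    where
    open ≡-Reasoning
    exchange : ∀ d e x → d * (e * x) ≡ e * (d * x)
    exchange = solve-∀

  triple : R → R → R → ℕ → ℕ
  triple f g h k = ∑ p (λ a → ∑ p (λ b → ∑ p (λ c → δ ((a + b + c) % p) k * (f a * g b * h c))))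

  ⊛-assoc-left : ∀ f g h k → ((f ⊛ g) ⊛ h) k ≡ triple f g h k
  ⊛-assoc-left f g h k = begin
    ∑ p (λ l → ∑ p (λ c → δ ((l + c) % p) k * ((f ⊛ g) l * h c)))
      ≡⟨ ∑-cong p (λ l → ∑-cong p (λ c → pullOut l c)) ⟩
    ∑ p (λ l → ∑ p (λ c → ∑ p (λ a → ∑ p (λ b → E l c a b))))
      ≡⟨ ∑-cong p (λ l → trans (∑-swap p p _) (∑-cong p (λ a → ∑-swap p p _))) ⟩
    ∑ p (λ l → ∑ p (λ a → ∑ p (λ b → ∑ p (λ c → E l c a b))))
      ≡⟨ trans (∑-swap p p _) (∑-cong p (λ a → trans (∑-swap p p _) (∑-cong p (λ b → ∑-swap p p _)))) ⟩
    ∑ p (λ a → ∑ p (λ b → ∑ p (λ c → ∑ p (λ l → E l c a b))))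
      ≡⟨ ∑-cong p (λ a → ∑-cong p (λ b → ∑-cong p (λ c → trans
           (∑-δʳ p ((a + b) % p) (λ l → δ ((l + c) % p) k * (f a * g b * h c)) (m%n<n (a + b) p))
           (cong (λ x → δ x k * (f a * g b * h c)) (%-absorbˡ {m = p} (a + b) c))))) ⟩
    triple f g h k ∎
    where
    open ≡-Reasoning
    E : ℕ → ℕ → ℕ → ℕ → ℕ
    E l c a b = δ ((a + b) % p) l * (δ ((l + c) % p) k * (f a * g b * h c))
    rearrange : ∀ d e x y z → d * (e * (x * y) * z) ≡ e * (d * (x * y * z))
    rearrange = solve-∀
    pullOut : ∀ l c → δ ((l + c) % p) k * ((f ⊛ g) l * h c) ≡ ∑ p (λ a → ∑ p (λ b → E l c a b))
    pullOut l c = begin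
      D * (∑ p (λ a → ∑ p (λ b → X a b)) * h c)     ≡⟨ cong (D *_) (trans (∑-*ʳ p (h c) _) (∑-cong p (λ a → ∑-*ʳ p (h c) _))) ⟩
      D * ∑ p (λ a → ∑ p (λ b → X a b * h c))       ≡⟨ trans (∑-*ˡ p D _) (∑-cong p (λ a → ∑-*ˡ p D _)) ⟩
      ∑ p (λ a → ∑ p (λ b → D * (X a b * h c)))     ≡⟨ ∑-cong p (λ a → ∑-cong p (λ b → rearrange D (δ ((a + b) % p) l) (f a) (g b) (h c))) ⟩
      ∑ p (λ a → ∑ p (λ b → E l c a b))             ∎
      where
      D : ℕ
      D = δ ((l + c) % p) k
      X : ℕ → ℕ → ℕ
      X a b = δ ((a + b) % p) l * (f a * g b)

  ⊛-assoc-right : ∀ f g h k → (f ⊛ (g ⊛ h)) k ≡ triple f g h k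
  ⊛-assoc-right f g h k = begin
    ∑ p (λ a → ∑ p (λ d → δ ((a + d) % p) k * (f a * (g ⊛ h) d)))
      ≡⟨ ∑-cong p (λ a → ∑-cong p (λ d → pullOut a d)) ⟩
    ∑ p (λ a → ∑ p (λ d → ∑ p (λ b → ∑ p (λ c → E a d b c))))
      ≡⟨ ∑-cong p (λ a → trans (∑-swap p p _) (∑-cong p (λ b → ∑-swap p p _))) ⟩
    ∑ p (λ a → ∑ p (λ b → ∑ p (λ c → ∑ p (λ d → E a d b c))))
      ≡⟨ ∑-cong p (λ a → ∑-cong p (λ b → ∑-cong p (λ c → trans
           (∑-δʳ p ((b + c) % p) (λ d → δ ((a + d) % p) k * (f a * g b * h c)) (m%n<n (b + c) p))
           (cong (λ x → δ x k * (f a * g b * h c)) (trans (%-absorbʳ {m = p} a (b + c)) (cong (_% p) (sym (+-assoc a b c)))))))) ⟩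
    triple f g h k ∎
    where
    open ≡-Reasoning
    E : ℕ → ℕ → ℕ → ℕ → ℕ
    E a d b c = δ ((b + c) % p) d * (δ ((a + d) % p) k * (f a * g b * h c))
    rearrange : ∀ d e x y z → d * (x * (e * (y * z))) ≡ e * (d * (x * y * z))
    rearrange = solve-∀
    pullOut : ∀ a d → δ ((a + d) % p) k * (f a * (g ⊛ h) d) ≡ ∑ p (λ b → ∑ p (λ c → E a d b c))
    pullOut a d = begin
      D * (f a * ∑ p (λ b → ∑ p (λ c → X b c)))     ≡⟨ cong (D *_) (trans (∑-*ˡ p (f a) _) (∑-cong p (λ b → ∑-*ˡ p (f a) _))) ⟩
      D * ∑ p (λ b → ∑ p (λ c → f a * X b c))       ≡⟨ trans (∑-*ˡ p D _) (∑-cong p (λ b → ∑-*ˡ p D _)) ⟩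
      ∑ p (λ b → ∑ p (λ c → D * (f a * X b c)))     ≡⟨ ∑-cong p (λ b → ∑-cong p (λ c → rearrange D (δ ((b + c) % p) d) (f a) (g b) (h c))) ⟩
      ∑ p (λ b → ∑ p (λ c → E a d b c))             ∎
      where
      D : ℕ
      D = δ ((a + d) % p) k
      X : ℕ → ℕ → ℕ
      X b c = δ ((b + c) % p) d * (g b * h c)

  ⊛-assoc : ∀ f g h → (f ⊛ g) ⊛ h ≈ f ⊛ (g ⊛ h)
  ⊛-assoc f g h k _ = trans (⊛-assoc-left f g h k) (sym (⊛-assoc-right f g h k))

  -- Packaging ℕ[ℤ/p] as a commutative semiring gives access to the library's
  -- powers and the binomial theorem.
  ≈-isEquivalence : IsEquivalence _≈_
  ≈-isEquivalence = record
    { refl  = λ _ _ → refl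
    ; sym   = λ f≈g k k<p → sym (f≈g k k<p)
    ; trans = λ f≈g g≈h k k<p → trans (f≈g k k<p) (g≈h k k<p) }

  ⊕-isCommutativeMonoid : IsCommutativeMonoid _≈_ _⊕_ 0R
  ⊕-isCommutativeMonoid = record
    { isMonoid = record
      { isSemigroup = record
        { isMagma = record
          { isEquivalence = ≈-isEquivalence
          ; ∙-cong        = λ f≈f′ g≈g′ k k<p → cong₂ _+_ (f≈f′ k k<p) (g≈g′ k k<p) }
        ; assoc = λ f g h k _ → +-assoc (f k) (g k) (h k) }
      ; identity = (λ f k _ → refl) , (λ f k _ → +-identityʳ (f k)) }
    ; comm = λ f g k _ → +-comm (f k) (g k) }

  ⊛-isCommutativeMonoid : IsCommutativeMonoid _≈_ _⊛_ 1R
  ⊛-isCommutativeMonoid = record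
    { isMonoid = record
      { isSemigroup = record
        { isMagma = record { isEquivalence = ≈-isEquivalence ; ∙-cong = ⊛-cong }
        ; assoc   = ⊛-assoc }
      ; identity = ⊛-identityˡ , (λ f k k<p → trans (⊛-comm f 1R k k<p) (⊛-identityˡ f k k<p)) }
    ; comm = ⊛-comm }

  ℕ[ℤ/p] : CommutativeSemiring _ _
  ℕ[ℤ/p] = record
    { Carrier = R ; _≈_ = _≈_ ; _+_ = _⊕_ ; _*_ = _⊛_ ; 0# = 0R ; 1# = 1R
    ; isCommutativeSemiring = isCommutativeSemiringˡ record
      { +-isCommutativeMonoid = ⊕-isCommutativeMonoid
      ; *-isCommutativeMonoid = ⊛-isCommutativeMonoid
      ; distribʳ              = ⊛-distribʳ
      ; zeroˡ                 = ⊛-zeroˡ } }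

  module ℕ[ℤ/p] = CommutativeSemiring ℕ[ℤ/p]
  open import Algebra.Properties.Semiring.Exp ℕ[ℤ/p].semiring public
    using (^-congˡ; ^-congʳ) renaming (_^_ to _^ᴿ_)

  mono : ℕ → ℕ → R
  mono c a k = δ a k * c

  mono-⊛ : ∀ c d a b → a < p → b < p → mono c a ⊛ mono d b ≈ mono (c * d) ((a + b) % p)
  mono-⊛ c d a b a<p b<p k _ = begin
    ∑ p (λ x → ∑ p (λ y → δ ((x + y) % p) k * (δ a x * c * (δ b y * d))))
      ≡⟨ ∑-cong p (λ x → ∑-cong p (λ y → rearrange (δ ((x + y) % p) k) (δ a x) (δ b y) c d)) ⟩
    ∑ p (λ x → ∑ p (λ y → δ a x * (δ b y * (δ ((x + y) % p) k * (c * d)))))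
      ≡⟨ ∑-cong p (λ x → sym (∑-*ˡ p (δ a x) _)) ⟩
    ∑ p (λ x → δ a x * ∑ p (λ y → δ b y * (δ ((x + y) % p) k * (c * d))))
      ≡⟨ ∑-δʳ p a _ a<p ⟩
    ∑ p (λ y → δ b y * (δ ((a + y) % p) k * (c * d)))
      ≡⟨ ∑-δʳ p b _ b<p ⟩
    δ ((a + b) % p) k * (c * d) ∎
    where
    open ≡-Reasoning
    rearrange : ∀ e x y c d → e * (x * c * (y * d)) ≡ x * (y * (e * (c * d)))
    rearrange = solve-∀

  mono-^ : ∀ c a n → a < p → mono c a ^ᴿ n ≈ mono (c ^ n) ((n * a) % p)
  mono-^ c a zero    a<p k _   = sym (trans (*-identityʳ _) (cong (λ x → δ x k) 0%m≡0))
  mono-^ c a (suc n) a<p k k<p =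
    trans (⊛-cong {mono c a} (λ _ _ → refl) (mono-^ c a n a<p) k k<p)
      (trans (mono-⊛ c (c ^ n) a ((n * a) % p) a<p (m%n<n (n * a) p) k k<p)
        (cong (λ x → δ x k * c ^ suc n) (%-absorbʳ {m = p} a (n * a))))

  _⊖_ : ℕ → ℕ → ℕ
  k ⊖ r = (k + (p ∸ r)) % p

  ⊖-<p : ∀ k r → k ⊖ r < p
  ⊖-<p k r = m%n<n (k + (p ∸ r)) p

  ⊖-+ : ∀ k r → k < p → r ≤ p → (k ⊖ r + r) % p ≡ k
  ⊖-+ k r k<p r≤p = begin
    ((k + (p ∸ r)) % p + r) % p ≡⟨ %-absorbˡ {m = p} (k + (p ∸ r)) r ⟩
    (k + (p ∸ r) + r) % p       ≡⟨ cong (_% p) (trans (+-assoc k (p ∸ r) r) (cong (k +_) (m∸n+n≡m r≤p))) ⟩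
    (k + p) % p                 ≡⟨ [m+n]%n≡m%n k p ⟩
    k % p                       ≡⟨ m<n⇒m%n≡m k<p ⟩
    k                           ∎
    where open ≡-Reasoning

  +-⊖ : ∀ a r k → a < p → r ≤ p → (a + r) % p ≡ k → a ≡ k ⊖ r
  +-⊖ a r k a<p r≤p a+r≡k = begin
    a                         ≡⟨ m<n⇒m%n≡m a<p ⟨
    a % p                     ≡⟨ [m+n]%n≡m%n a p ⟨
    (a + p) % p               ≡⟨ cong (λ x → (a + x) % p) (m+[n∸m]≡n r≤p) ⟨
    (a + (r + (p ∸ r))) % p   ≡⟨ cong (_% p) (+-assoc a r (p ∸ r)) ⟨
    (a + r + (p ∸ r)) % p     ≡⟨ %-absorbˡ {m = p} (a + r) (p ∸ r) ⟨
    ((a + r) % p + (p ∸ r)) % p ≡⟨ cong (λ x → (x + (p ∸ r)) % p) a+r≡k ⟩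
    k ⊖ r                     ∎
    where open ≡-Reasoning

  k⊖0≡k : ∀ {k} → k < p → k ⊖ 0 ≡ k
  k⊖0≡k {k} k<p = trans ([m+n]%n≡m%n k p) (m<n⇒m%n≡m k<p)

  ∑-δ-shift : ∀ k r → k < p → r ≤ p → ∀ (F : ℕ → ℕ) → ∑ p (λ a → δ ((a + r) % p) k * F a) ≡ F (k ⊖ r)
  ∑-δ-shift k r k<p r≤p F =
    ∑-δ-unique p (λ a → (a + r) % p) k F (k ⊖ r) (⊖-<p k r) (⊖-+ k r k<p r≤p) (λ a a<p → +-⊖ a r k a<p r≤p)

  -- 0 ⊖ (c ⊖ b) = b ⊖ c, since (b ⊖ c) + (c ⊖ b) ≡ 0.
  ⊖-flip : ∀ b c → b < p → c < p → 0 ⊖ (c ⊖ b) ≡ b ⊖ c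
  ⊖-flip b c b<p c<p = sym (+-⊖ (b ⊖ c) (c ⊖ b) 0 (⊖-<p b c) (<⇒≤ (⊖-<p c b)) (begin
    ((b + (p ∸ c)) % p + (c + (p ∸ b)) % p) % p ≡⟨ %-absorbˡ {m = p} (b + (p ∸ c)) _ ⟩
    (b + (p ∸ c) + (c + (p ∸ b)) % p) % p       ≡⟨ %-absorbʳ {m = p} (b + (p ∸ c)) _ ⟩
    (b + (p ∸ c) + (c + (p ∸ b))) % p           ≡⟨ cong (_% p) (regroup b c (p ∸ b) (p ∸ c)) ⟩
    ((b + (p ∸ b)) + (c + (p ∸ c))) % p         ≡⟨ cong (_% p) (cong₂ _+_ (m+[n∸m]≡n (<⇒≤ b<p)) (m+[n∸m]≡n (<⇒≤ c<p))) ⟩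
    (p + p) % p                                 ≡⟨ trans ([m+n]%n≡m%n p p) (n%n≡0 p) ⟩
    0                                           ∎))
    where
    open ≡-Reasoning
    regroup : ∀ b c x y → b + y + (c + x) ≡ (b + x) + (c + y)
    regroup = solve-∀

  ⊛-mono : ∀ A c r k → r < p → k < p → (A ⊛ mono c r) k ≡ A (k ⊖ r) * c
  ⊛-mono A c r k r<p k<p = begin
    ∑ p (λ a → ∑ p (λ b → δ ((a + b) % p) k * (A a * (δ r b * c))))
      ≡⟨ ∑-cong p (λ a → ∑-cong p (λ b → rearrange (δ ((a + b) % p) k) (A a) (δ r b) c)) ⟩
    ∑ p (λ a → ∑ p (λ b → δ r b * (δ ((a + b) % p) k * (A a * c))))
      ≡⟨ ∑-cong p (λ a → ∑-δʳ p r _ r<p) ⟩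
    ∑ p (λ a → δ ((a + r) % p) k * (A a * c))
      ≡⟨ ∑-δ-shift k r k<p (<⇒≤ r<p) (λ a → A a * c) ⟩
    A (k ⊖ r) * c ∎
    where
    open ≡-Reasoning
    rearrange : ∀ d x e c → d * (x * (e * c)) ≡ e * (d * (x * c))
    rearrange = solve-∀

  S : R → ℕ
  S f = ∑ p f

  S-⊛ : ∀ A B → S (A ⊛ B) ≡ S A * S B
  S-⊛ A B = begin
    ∑ p (λ k → ∑ p (λ a → ∑ p (λ b → δ ((a + b) % p) k * (A a * B b))))
      ≡⟨ trans (∑-swap p p _) (∑-cong p (λ a → ∑-swap p p _)) ⟩
    ∑ p (λ a → ∑ p (λ b → ∑ p (λ k → δ ((a + b) % p) k * (A a * B b))))
      ≡⟨ ∑-cong p (λ a → ∑-cong p (λ b → ∑-δʳ p ((a + b) % p) (λ _ → A a * B b) (m%n<n _ p))) ⟩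
    ∑ p (λ a → ∑ p (λ b → A a * B b))
      ≡⟨ ∑-cong p (λ a → sym (∑-*ˡ p (A a) B)) ⟩
    ∑ p (λ a → A a * S B)
      ≡⟨ sym (∑-*ʳ p (S B) A) ⟩
    S A * S B ∎
    where open ≡-Reasoning

  S-⊕ : ∀ A B → S (A ⊕ B) ≡ S A + S B
  S-⊕ = ∑-+ p

  S-mono : ∀ c r → r < p → S (mono c r) ≡ c
  S-mono c r r<p = ∑-δʳ p r (λ _ → c) r<p

  S-1R : S 1R ≡ 1
  S-1R = trans (∑-cong p (λ k → sym (*-identityʳ (δ 0 k)))) (S-mono 1 0 (>-nonZero⁻¹ p))

  const : ℕ → R
  const c _ = c

  const-⊛ : ∀ c B k → k < p → (const c ⊛ B) k ≡ c * S B
  const-⊛ c B k k<p = begin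
    ∑ p (λ a → ∑ p (λ b → δ ((a + b) % p) k * (c * B b)))  ≡⟨ ∑-swap p p _ ⟩
    ∑ p (λ b → ∑ p (λ a → δ ((a + b) % p) k * (c * B b)))  ≡⟨ ∑-cong< p (λ b b<p → ∑-δ-shift k b k<p (<⇒≤ b<p) (λ _ → c * B b)) ⟩
    ∑ p (λ b → c * B b)                                     ≡⟨ ∑-*ˡ p c B ⟨
    c * S B                                                 ∎
    where open ≡-Reasoning

  ∑R : ℕ → (ℕ → R) → R
  ∑R n G k = ∑ n (λ m → G m k)

  ⊛-∑R : ∀ W n G → W ⊛ ∑R n G ≈ ∑R n (λ m → W ⊛ G m)
  ⊛-∑R W zero    G = ℕ[ℤ/p].zeroʳ W
  ⊛-∑R W (suc n) G k k<p =
    trans (ℕ[ℤ/p].distribˡ W (∑R n G) (G n) k k<p) (cong (_+ (W ⊛ G n) k) (⊛-∑R W n G k k<p))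

  reverse : R → R
  reverse V a = V (0 ⊖ a)

  correlation : ∀ V X c → c < p → ∑ p (λ i → V i * X ((i + c) % p)) ≡ (reverse V ⊛ X) c
  correlation V X c c<p = begin
    ∑ p (λ i → V i * X ((i + c) % p))
      ≡⟨ ∑-cong p (λ i → cong (V i *_) (sym (∑-δʳ p ((i + c) % p) X (m%n<n _ p)))) ⟩
    ∑ p (λ i → V i * ∑ p (λ b → δ ((i + c) % p) b * X b))
      ≡⟨ ∑-cong p (λ i → trans (∑-*ˡ p (V i) _) (∑-cong p (λ b → rearrange (V i) (δ ((i + c) % p) b) (X b)))) ⟩
    ∑ p (λ i → ∑ p (λ b → δ ((i + c) % p) b * (X b * V i)))
      ≡⟨ ∑-swap p p _ ⟩
    ∑ p (λ b → ∑ p (λ i → δ ((i + c) % p) b * (X b * V i)))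
      ≡⟨ ∑-cong< p (λ b b<p → ∑-δ-shift b c b<p (<⇒≤ c<p) (λ i → X b * V i)) ⟩
    ∑ p (λ b → X b * V (b ⊖ c))
      ≡⟨ ∑-cong< p (λ b b<p → trans (*-comm (X b) _) (cong (λ i → V i * X b) (sym (⊖-flip b c b<p c<p)))) ⟩
    ∑ p (λ b → reverse V (c ⊖ b) * X b)
      ≡⟨ ∑-cong< p (λ b b<p → ∑-δ-shift c b c<p (<⇒≤ b<p) (λ a → reverse V a * X b)) ⟨
    ∑ p (λ b → ∑ p (λ a → δ ((a + b) % p) c * (reverse V a * X b)))
      ≡⟨ ∑-swap p p _ ⟩
    (reverse V ⊛ X) c ∎
    where
    open ≡-Reasoning
    rearrange : ∀ v d x → v * (d * x) ≡ d * (x * v)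
    rearrange = solve-∀

module Frobenius (p q : ℕ) .{{_ : NonZero p}} .{{_ : NonZero q}} (pq : Prime q) where
  open GroupRing p
  open import Algebra.Properties.Monoid.Mult ℕ[ℤ/p].+-monoid using () renaming (_×_ to _·ᴿ_)
  open import Algebra.Properties.CommutativeSemiring.Exp ℕ[ℤ/p] using (^-distrib-*)
  open FreshmansDream ℕ[ℤ/p] using (freshmansDream)

  infix 4 _≋_
  _≋_ : R → R → Set
  f ≋ g = ∀ k → k < p → f k ≡ g k [mod q ]

  ≈⇒≋ : ∀ {f g} → f ≈ g → f ≋ g
  ≈⇒≋ f≈g k k<p = cong (_% q) (f≈g k k<p)

  ≋-trans : ∀ {f g h} → f ≋ g → g ≋ h → f ≋ h
  ≋-trans f≋g g≋h k k<p = trans (f≋g k k<p) (g≋h k k<p)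

  ≋-sym : ∀ {f g} → f ≋ g → g ≋ f
  ≋-sym f≋g k k<p = sym (f≋g k k<p)

  ⊕-≋ : ∀ {f f′ g g′} → f ≋ f′ → g ≋ g′ → f ⊕ g ≋ f′ ⊕ g′
  ⊕-≋ f≋f′ g≋g′ k k<p = +-mod (f≋f′ k k<p) (g≋g′ k k<p)

  ⊛-≋ : ∀ {f f′ g g′} → f ≋ f′ → g ≋ g′ → f ⊛ g ≋ f′ ⊛ g′
  ⊛-≋ f≋f′ g≋g′ k _ = ∑-mod p (λ a a<p → ∑-mod p (λ b b<p →
    *-mod {a = δ ((a + b) % p) k} refl (*-mod (f≋f′ a a<p) (g≋g′ b b<p))))

  φ : R → R
  φ f k = ∑ p (λ a → δ ((q * a) % p) k * f a)

  φ-≋ : ∀ {f g} → f ≋ g → φ f ≋ φ g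
  φ-≋ f≋g k _ = ∑-mod p (λ a a<p → *-mod {a = δ ((q * a) % p) k} refl (f≋g a a<p))

  φ-≈ : ∀ {f g} → f ≈ g → φ f ≈ φ g
  φ-≈ f≈g k _ = ∑-cong< p (λ a a<p → cong (δ ((q * a) % p) k *_) (f≈g a a<p))

  φ-⊕ : ∀ f g → φ (f ⊕ g) ≈ φ f ⊕ φ g
  φ-⊕ f g k _ = trans (∑-cong p (λ a → *-distribˡ-+ (δ ((q * a) % p) k) (f a) (g a))) (∑-+ p _ _)

  φ-0R : φ 0R ≈ 0R
  φ-0R k _ = ∑-zero p _ (λ a _ → *-zeroʳ (δ ((q * a) % p) k))

  φ-mono : ∀ c a → a < p → φ (mono c a) ≈ mono c ((q * a) % p)
  φ-mono c a a<p k _ =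
    trans (∑-cong p (λ b → exchange (δ ((q * b) % p) k) (δ a b) c)) (∑-δʳ p a (λ b → δ ((q * b) % p) k * c) a<p)
    where
    exchange : ∀ x y c → x * (y * c) ≡ y * (x * c)
    exchange = solve-∀

  frobenius-⊕ : ∀ f g → (f ⊕ g) ^ᴿ q ≋ f ^ᴿ q ⊕ g ^ᴿ q
  frobenius-⊕ f g with freshmansDream q (>-nonZero⁻¹ q) (prime∣binomial pq) f g
  ... | z , dream = λ k k<p → begin
    ((f ⊕ g) ^ᴿ q) k % q                        ≡⟨ cong (_% q) (dream k k<p) ⟩
    ((f ^ᴿ q) k + (g ^ᴿ q) k + (q ·ᴿ z) k) % q   ≡⟨ cong (λ x → ((f ^ᴿ q) k + (g ^ᴿ q) k + x) % q) (trans (×-pointwise q z k) (*-comm q (z k))) ⟩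
    ((f ^ᴿ q) k + (g ^ᴿ q) k + z k * q) % q     ≡⟨ [m+kn]%n≡m%n _ (z k) q ⟩
    ((f ^ᴿ q) k + (g ^ᴿ q) k) % q               ∎
    where
    open ≡-Reasoning
    ×-pointwise : ∀ n h k → (n ·ᴿ h) k ≡ n * h k
    ×-pointwise zero    h k = refl
    ×-pointwise (suc n) h k = cong (h k +_) (×-pointwise n h k)

  -- Monomials: (c xᵃ)ᵠ = cᵠ x^(qa) ≡ c x^(qa) by Fermat.
  frobenius-mono : ∀ c a → a < p → mono c a ^ᴿ q ≋ φ (mono c a)
  frobenius-mono c a a<p = ≋-trans (≈⇒≋ (mono-^ c a q a<p))
    (≋-trans (λ k _ → *-mod {a = δ ((q * a) % p) k} refl (fermat pq c)) (≈⇒≋ (λ k k<p → sym (φ-mono c a a<p k k<p))))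

  truncate : R → ℕ → R
  truncate f zero    = 0R
  truncate f (suc n) = truncate f n ⊕ mono (f n) n

  truncate-full : ∀ f → truncate f p ≈ f
  truncate-full f k k<p = trans (truncated k p) (∑-δˡ p k f k<p)
    where
    truncated : ∀ k n → truncate f n k ≡ ∑ n (λ a → δ a k * f a)
    truncated k zero    = refl
    truncated k (suc n) = cong (_+ δ n k * f n) (truncated k n)

  frobenius-truncate : ∀ f n → n ≤ p → truncate f n ^ᴿ q ≋ φ (truncate f n)
  frobenius-truncate f zero    _   = ≈⇒≋ (λ k k<p → trans (0R^q k k<p) (sym (φ-0R k k<p)))
    where
    0R^q : 0R ^ᴿ q ≈ 0R
    0R^q = ℕ[ℤ/p].trans (^-congʳ 0R (sym (suc-pred q))) (⊛-zeroˡ (0R ^ᴿ pred q))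
  frobenius-truncate f (suc n) n<p = ≋-trans (frobenius-⊕ (truncate f n) (mono (f n) n))
    (≋-trans (⊕-≋ (frobenius-truncate f n (≤-trans (n≤1+n n) n<p)) (frobenius-mono (f n) n n<p))
      (≈⇒≋ (λ k k<p → sym (φ-⊕ (truncate f n) (mono (f n) n) k k<p))))

  frobenius : ∀ f → f ^ᴿ q ≋ φ f
  frobenius f = ≋-trans (≈⇒≋ (^-congˡ q (λ k k<p → sym (truncate-full f k k<p))))
    (≋-trans (frobenius-truncate f p ≤-refl) (≈⇒≋ (φ-≈ (truncate-full f))))

  φ^ : ℕ → R → R
  φ^ zero    f = f
  φ^ (suc m) f = φ (φ^ m f)

  φ^-coefficient : ∀ m f j → j < p → φ^ m f j ≡ ∑ p (λ a → δ ((q ^ m * a) % p) j * f a)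
  φ^-coefficient zero f j j<p = sym (trans
    (∑-cong< p (λ a a<p → cong (λ z → δ z j * f a) (trans (cong (_% p) (*-identityˡ a)) (m<n⇒m%n≡m a<p))))
    (∑-δˡ p j f j<p))
  φ^-coefficient (suc m) f j j<p = begin
    ∑ p (λ b → δ ((q * b) % p) j * φ^ m f b)
      ≡⟨ ∑-cong< p (λ b b<p → cong (δ ((q * b) % p) j *_) (φ^-coefficient m f b b<p)) ⟩
    ∑ p (λ b → δ ((q * b) % p) j * ∑ p (λ a → δ ((q ^ m * a) % p) b * f a))
      ≡⟨ ∑-cong p (λ b → ∑-*ˡ p (δ ((q * b) % p) j) (λ a → δ ((q ^ m * a) % p) b * f a)) ⟩
    ∑ p (λ b → ∑ p (λ a → δ ((q * b) % p) j * (δ ((q ^ m * a) % p) b * f a)))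
      ≡⟨ ∑-swap p p _ ⟩
    ∑ p (λ a → ∑ p (λ b → δ ((q * b) % p) j * (δ ((q ^ m * a) % p) b * f a)))
      ≡⟨ ∑-cong p (λ a → ∑-cong p (λ b → exchange (δ ((q * b) % p) j) (δ ((q ^ m * a) % p) b) (f a))) ⟩
    ∑ p (λ a → ∑ p (λ b → δ ((q ^ m * a) % p) b * (δ ((q * b) % p) j * f a)))
      ≡⟨ ∑-cong p (λ a → ∑-δʳ p ((q ^ m * a) % p) (λ b → δ ((q * b) % p) j * f a) (m%n<n _ p)) ⟩
    ∑ p (λ a → δ ((q * ((q ^ m * a) % p)) % p) j * f a)
      ≡⟨ ∑-cong p (λ a → cong (λ z → δ z j * f a) (trans (*-mod {m = p} {a = q} refl (%-mod (q ^ m * a)))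
                                                        (cong (_% p) (sym (*-assoc q (q ^ m) a))))) ⟩
    ∑ p (λ a → δ ((q * q ^ m * a) % p) j * f a) ∎
    where
    open ≡-Reasoning
    exchange : ∀ x y z → x * (y * z) ≡ y * (x * z)
    exchange = solve-∀

  -- The multiples of W are stable under φ (modulo q): φᵐ (W X₀) ≡ W Yₘ with
  -- Y₀ = X₀ and Yₘ₊₁ = W^(q-1) Yₘᵠ, because φ (W Y) ≡ (W Y)ᵠ = W · W^(q-1) Yᵠ.
  module MultiplesOf (W X₀ : R) where
    Y : ℕ → R
    Y zero    = X₀
    Y (suc m) = W ^ᴿ (q ∸ 1) ⊛ Y m ^ᴿ q

    φ^-multiple : ∀ m → φ^ m (W ⊛ X₀) ≋ W ⊛ Y m
    φ^-multiple zero    k _ = refl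
    φ^-multiple (suc m) = ≋-trans (φ-≋ (φ^-multiple m)) (≋-trans (≋-sym (frobenius (W ⊛ Y m)))
      (≈⇒≋ (ℕ[ℤ/p].trans (^-distrib-* W (Y m) q)
             (ℕ[ℤ/p].trans (ℕ[ℤ/p].*-congʳ W^q) (ℕ[ℤ/p].*-assoc W (W ^ᴿ (q ∸ 1)) (Y m ^ᴿ q))))))
      where
      W^q : W ^ᴿ q ≈ W ⊛ W ^ᴿ (q ∸ 1)
      W^q = ^-congʳ W (sym (suc-pred q))

module _ where
  open import Data.Fin using (Fin; toℕ; fromℕ<; punchOut)
  open import Data.Fin.Properties using (any?; pigeonhole; punchOut-injective; toℕ-fromℕ<; toℕ-injective; toℕ<n)
  import Data.Fin.Properties as Fin

  injective⇒surjective-Fin : ∀ n (g : Fin n → Fin n) → (∀ i j → g i ≡ g j → i ≡ j) → ∀ y → ∃ λ i → g i ≡ y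
  injective⇒surjective-Fin (suc n) g injective y with any? (λ i → g i Fin.≟ y)
  ... | yes hit = hit
  ... | no miss with pigeonhole (n<1+n n) (λ i → punchOut {i = y} {j = g i} (λ y≡gi → miss (i , sym y≡gi)))
  ...   | i , j , i<j , collision =
    ⊥-elim (<⇒≢ i<j (cong toℕ (injective i j
      (punchOut-injective {i = y} (λ e → miss (i , sym e)) (λ e → miss (j , sym e)) collision))))

  injective⇒surjective : ∀ n (g : ℕ → ℕ) → (∀ m → m < n → g m < n) →
                         (∀ m₁ m₂ → m₁ < n → m₂ < n → g m₁ ≡ g m₂ → m₁ ≡ m₂) →
                         ∀ y → y < n → ∃ λ m → m < n × g m ≡ y
  injective⇒surjective n g into injective y y<n with injective⇒surjective-Fin n G G-injective (fromℕ< y<n)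
    where
    G : Fin n → Fin n
    G i = fromℕ< (into (toℕ i) (toℕ<n i))
    toℕ-G : ∀ i → toℕ (G i) ≡ g (toℕ i)
    toℕ-G i = toℕ-fromℕ< (into (toℕ i) (toℕ<n i))
    G-injective : ∀ i j → G i ≡ G j → i ≡ j
    G-injective i j Gi≡Gj = toℕ-injective (injective (toℕ i) (toℕ j) (toℕ<n i) (toℕ<n j)
      (trans (sym (toℕ-G i)) (trans (cong toℕ Gi≡Gj) (toℕ-G j))))
  ... | i , Gi≡y = toℕ i , toℕ<n i ,
    trans (sym (toℕ-fromℕ< (into (toℕ i) (toℕ<n i)))) (trans (cong toℕ Gi≡y) (toℕ-fromℕ< y<n))

module PowerOrbits (p g : ℕ) .{{_ : NonZero p}} .{{_ : NonZero g}}
                   (pp : Prime p) (prim : PrimitiveRootMod p g) where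
  open PrimitiveRootMod prim

  p∤g^ : ∀ m → ¬ p ∣ g ^ m
  p∤g^ zero    p∣1 = <⇒≢ (prime≥2 pp) (sym (∣1⇒≡1 p∣1))
  p∤g^ (suc m) p∣g^[1+m] with euclidsLemma g (g ^ m) pp p∣g^[1+m]
  ... | inj₁ p∣g   = <⇒≢ (prime≥2 pp) (sym (coprime (p∣g , ∣-refl)))
  ... | inj₂ p∣g^m = p∤g^ m p∣g^m

  p∤g^m*a : ∀ m {a} → 0 < a → a < p → ¬ p ∣ g ^ m * a
  p∤g^m*a m {a} 0<a a<p p∣g^m*a with euclidsLemma (g ^ m) a pp p∣g^m*a
  ... | inj₁ p∣g^m = p∤g^ m p∣g^m
  ... | inj₂ p∣a   = <⇒≱ a<p (∣⇒≤ {{>-nonZero 0<a}} p∣a)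

  orbit-nonzero : ∀ m {a} → 0 < a → a < p → 0 < (g ^ m * a) % p
  orbit-nonzero m {a} 0<a a<p with (g ^ m * a) % p in eq
  ... | zero  = ⊥-elim (p∤g^m*a m 0<a a<p (m%n≡0⇒n∣m _ p eq))
  ... | suc _ = z<s

  -- gᵐ¹ a ≡ gᵐ² a with m₁ < m₂ < p - 1 would give g^(m₂ - m₁) ≡ 1, contradicting minimality.
  orbit-injective< : ∀ {a m₁ m₂} → 0 < a → a < p → m₁ < m₂ → m₂ < p ∸ 1 →
                     (g ^ m₁ * a) % p ≢ (g ^ m₂ * a) % p
  orbit-injective< {a} {m₁} {m₂} 0<a a<p m₁<m₂ m₂<p-1 same =
    minimal d (m<n⇒0<n∸m m₁<m₂) (≤-<-trans (m∸n≤m m₂ m₁) m₂<p-1)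
      (cancel-mod-prime pp (p∤g^m*a m₁ 0<a a<p) (m^n>0 g d) (trans (cong (_% p) (sym split)) (sym same)))
    where
    d : ℕ
    d = m₂ ∸ m₁
    split : g ^ m₂ * a ≡ g ^ m₁ * a * g ^ d
    split = begin
      g ^ m₂ * a          ≡⟨ cong (λ e → g ^ e * a) (m+[n∸m]≡n (<⇒≤ m₁<m₂)) ⟨
      g ^ (m₁ + d) * a    ≡⟨ cong (_* a) (^-distribˡ-+-* g m₁ d) ⟩
      g ^ m₁ * g ^ d * a  ≡⟨ regroup (g ^ m₁) (g ^ d) a ⟩
      g ^ m₁ * a * g ^ d  ∎
      where
      open ≡-Reasoning
      regroup : ∀ x y z → x * y * z ≡ x * z * y
      regroup = solve-∀

  orbit-injective : ∀ {a m₁ m₂} → 0 < a → a < p → m₁ < p ∸ 1 → m₂ < p ∸ 1 →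
                    (g ^ m₁ * a) % p ≡ (g ^ m₂ * a) % p → m₁ ≡ m₂
  orbit-injective {a} {m₁} {m₂} 0<a a<p m₁<p-1 m₂<p-1 same with <-cmp m₁ m₂
  ... | tri< m₁<m₂ _ _ = ⊥-elim (orbit-injective< 0<a a<p m₁<m₂ m₂<p-1 same)
  ... | tri≈ _ m₁≡m₂ _ = m₁≡m₂
  ... | tri> _ _ m₂<m₁ = ⊥-elim (orbit-injective< 0<a a<p m₂<m₁ m₁<p-1 (sym same))

  -- Discrete logarithm: injectivity on the p - 1 nonzero residues gives surjectivity.
  orbit-surjective : ∀ {a j} → 0 < a → a < p → 0 < j → j < p → ∃ λ m → m < p ∸ 1 × (g ^ m * a) % p ≡ j
  orbit-surjective {a} {j} 0<a a<p 0<j j<p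
    with injective⇒surjective (p ∸ 1) pos into injective (j ∸ 1) (∸-monoˡ-< j<p 0<j)
    where
    pos : ℕ → ℕ
    pos m = (g ^ m * a) % p ∸ 1
    into : ∀ m → m < p ∸ 1 → pos m < p ∸ 1
    into m _ = ∸-monoˡ-< (m%n<n (g ^ m * a) p) (orbit-nonzero m 0<a a<p)
    injective : ∀ m₁ m₂ → m₁ < p ∸ 1 → m₂ < p ∸ 1 → pos m₁ ≡ pos m₂ → m₁ ≡ m₂
    injective m₁ m₂ m₁<p-1 m₂<p-1 e = orbit-injective 0<a a<p m₁<p-1 m₂<p-1
      (trans (sym (m∸n+n≡m (orbit-nonzero m₁ 0<a a<p))) (trans (cong (_+ 1) e) (m∸n+n≡m (orbit-nonzero m₂ 0<a a<p))))
  ... | m , m<p-1 , e = m , m<p-1 ,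
    trans (sym (m∸n+n≡m (orbit-nonzero m 0<a a<p))) (trans (cong (_+ 1) e) (m∸n+n≡m 0<j))

  hits : ℕ → ℕ → ℕ
  hits a j = ∑ (p ∸ 1) (λ m → δ ((g ^ m * a) % p) j * 1)

  g^m*0≡0 : ∀ m → (g ^ m * 0) % p ≡ 0
  g^m*0≡0 m = trans (cong (_% p) (*-zeroʳ (g ^ m))) 0%m≡0

  hits-0-0 : hits 0 0 ≡ p ∸ 1
  hits-0-0 = trans (∑-cong (p ∸ 1) (λ m → cong (λ z → δ z 0 * 1) (g^m*0≡0 m)))
                   (trans (∑-const (p ∸ 1) 1) (*-identityʳ _))

  hits-0-j : ∀ {j} → 0 < j → hits 0 j ≡ 0
  hits-0-j {j} 0<j = ∑-δ-none (p ∸ 1) _ j (λ _ → 1) (λ m _ e → <⇒≢ 0<j (trans (sym (g^m*0≡0 m)) e))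

  hits-a-0 : ∀ {a} → 0 < a → a < p → hits a 0 ≡ 0
  hits-a-0 0<a a<p = ∑-δ-none (p ∸ 1) _ 0 (λ _ → 1) (λ m _ e → <⇒≢ (orbit-nonzero m 0<a a<p) (sym e))

  hits-a-j : ∀ {a j} → 0 < a → a < p → 0 < j → j < p → hits a j ≡ 1
  hits-a-j {a} {j} 0<a a<p 0<j j<p with orbit-surjective 0<a a<p 0<j j<p
  ... | m₀ , m₀<p-1 , hit = ∑-δ-unique (p ∸ 1) (λ m → (g ^ m * a) % p) j (λ _ → 1) m₀ m₀<p-1 hit
          (λ m m<p-1 e → orbit-injective 0<a a<p m<p-1 m₀<p-1 (trans e (sym hit)))

odd⇒3+2m : ∀ n → ¬ 2 ∣ n → 3 ≤ n → ∃ λ m → n ≡ 3 + (m + m)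
odd⇒3+2m 0 _ ()
odd⇒3+2m 1 _ (s≤s ())
odd⇒3+2m 2 _ (s≤s (s≤s ()))
odd⇒3+2m 3 _   _ = 0 , refl
odd⇒3+2m 4 2∤4 _ = ⊥-elim (2∤4 (divides 2 refl))
odd⇒3+2m (suc (suc (suc (suc (suc n))))) 2∤n _
  with odd⇒3+2m (3 + n) (λ 2∣3+n → 2∤n (∣m∣n⇒∣m+n (∣-refl {2}) 2∣3+n)) (s≤s (s≤s (s≤s z≤n)))
... | m , 3+n≡3+2m = suc m , trans (cong (2 +_) 3+n≡3+2m) (cong (4 +_) (sym (+-suc m m)))

-- For q ≥ 3, the sequence q-2, 1, 1, 1, q-1, 1, q-1, … has no entry divisible
-- by q, and its first 3 + 2m entries sum to q (m + 1): a "nowhere zero" vector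
-- of 𝔽_q^n with coordinate sum 0, for every odd n ≥ 3.
module ZeroSumPattern (q : ℕ) (3≤q : 3 ≤ q) where

  alternating : ℕ → ℕ
  alternating zero          = 1
  alternating (suc zero)    = q ∸ 1
  alternating (suc (suc k)) = alternating k

  zeroSum : ℕ → ℕ
  zeroSum zero                = q ∸ 2
  zeroSum (suc zero)          = 1
  zeroSum (suc (suc zero))    = 1
  zeroSum (suc (suc (suc k))) = alternating k

  alternating-even : ∀ m → alternating (m + m) ≡ 1
  alternating-even zero    = refl
  alternating-even (suc m) rewrite +-suc m m = alternating-even m

  alternating-odd : ∀ m → alternating (suc (m + m)) ≡ q ∸ 1
  alternating-odd zero    = refl
  alternating-odd (suc m) rewrite +-suc m m = alternating-odd m

  ∑-zeroSum : ∀ m → ∑ (3 + (m + m)) zeroSum ≡ q * suc m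
  ∑-zeroSum zero = begin
    0 + (q ∸ 2) + 1 + 1  ≡⟨ cong (_+ 1) (+-comm (q ∸ 2) 1) ⟩
    1 + (q ∸ 2) + 1      ≡⟨ +-comm (1 + (q ∸ 2)) 1 ⟩
    2 + (q ∸ 2)          ≡⟨ m+[n∸m]≡n (≤-trans (s≤s (s≤s z≤n)) 3≤q) ⟩
    q                    ≡⟨ *-identityʳ q ⟨
    q * 1                ∎
    where open ≡-Reasoning
  ∑-zeroSum (suc m) rewrite +-suc m m | alternating-even m | alternating-odd m | ∑-zeroSum m = begin
    q * suc m + 1 + (q ∸ 1)    ≡⟨ +-assoc (q * suc m) 1 (q ∸ 1) ⟩
    q * suc m + (1 + (q ∸ 1))  ≡⟨ cong (q * suc m +_) (m+[n∸m]≡n (≤-trans (s≤s z≤n) 3≤q)) ⟩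
    q * suc m + q              ≡⟨ +-comm (q * suc m) q ⟩
    q + q * suc m              ≡⟨ *-suc q (suc m) ⟨
    q * suc (suc m)            ∎
    where open ≡-Reasoning

  zeroSum-range : ∀ k → 0 < zeroSum k × zeroSum k < q
  zeroSum-range zero                = m<n⇒0<n∸m 3≤q , ∸-monoʳ-< z<s (≤-trans (s≤s (s≤s z≤n)) 3≤q)
  zeroSum-range (suc zero)          = z<s , ≤-trans (s≤s (s≤s z≤n)) 3≤q
  zeroSum-range (suc (suc zero))    = z<s , ≤-trans (s≤s (s≤s z≤n)) 3≤q
  zeroSum-range (suc (suc (suc k))) = alternating-range k
    where
    alternating-range : ∀ k → 0 < alternating k × alternating k < q
    alternating-range zero          = z<s , ≤-trans (s≤s (s≤s z≤n)) 3≤q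
    alternating-range (suc zero)    = m<n⇒0<n∸m (≤-trans (s≤s (s≤s z≤n)) 3≤q) , ∸-monoʳ-< z<s (≤-trans (s≤s z≤n) 3≤q)
    alternating-range (suc (suc k)) = alternating-range k

module NowhereZeroMultiple (p q : ℕ) .{{_ : NonZero p}} .{{_ : NonZero q}}
         (pp : Prime p) (pq : Prime q) (2∤q : ¬ 2 ∣ q) (q<p : q < p) (prim : PrimitiveRootMod p q) where
  open GroupRing p
  open Frobenius p q pq
  open PowerOrbits p q pp prim

  NowhereZero : R → Set
  NowhereZero f = ∀ k → k < p → ¬ (f k ≡ 0 [mod q ])

  3≤q : 3 ≤ q
  3≤q = oddPrime≥3 pq 2∤q

  p≡3+2m : ∃ λ m → p ≡ 3 + (m + m)
  p≡3+2m = odd⇒3+2m p 2∤p (≤-trans 3≤q (<⇒≤ q<p))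
    where
    2∤p : ¬ 2 ∣ p
    2∤p 2∣p with prime⇒irreducible pp 2∣p
    ... | inj₁ ()
    ... | inj₂ 2≡p = <⇒≱ q<p (subst (_≤ q) 2≡p (≤-trans (n≤1+n 2) 3≤q))

  q∤p : ¬ q ∣ p
  q∤p q∣p with prime⇒irreducible pp q∣p
  ... | inj₁ q≡1 = <⇒≢ (prime≥2 pq) (sym q≡1)
  ... | inj₂ q≡p = <⇒≢ q<p q≡p

  -- The trace Tr f = ∑_{m < p-1} φᵐ f.  Since q generates (ℤ/p)ˣ, its
  -- coefficients are (p - 1) f₀ at 0 and S f - f₀ everywhere else.
  Tr : R → R
  Tr f j = ∑ (p ∸ 1) (λ m → φ^ m f j)

  Tr-coefficient : ∀ f j → j < p → Tr f j ≡ ∑ p (λ a → hits a j * f a)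
  Tr-coefficient f j j<p = begin
    ∑ (p ∸ 1) (λ m → φ^ m f j)                                      ≡⟨ ∑-cong (p ∸ 1) (λ m → φ^-coefficient m f j j<p) ⟩
    ∑ (p ∸ 1) (λ m → ∑ p (λ a → δ ((q ^ m * a) % p) j * f a))      ≡⟨ ∑-swap (p ∸ 1) p _ ⟩
    ∑ p (λ a → ∑ (p ∸ 1) (λ m → δ ((q ^ m * a) % p) j * f a))      ≡⟨ ∑-cong p (λ a → sym (collect a)) ⟩
    ∑ p (λ a → hits a j * f a)                                      ∎
    where
    open ≡-Reasoning
    collect : ∀ a → hits a j * f a ≡ ∑ (p ∸ 1) (λ m → δ ((q ^ m * a) % p) j * f a)
    collect a = trans (∑-*ʳ (p ∸ 1) (f a) _) (∑-cong (p ∸ 1) (λ m → cong (_* f a) (*-identityʳ (δ ((q ^ m * a) % p) j))))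

  ∑-split-0 : ∀ F → ∑ p F ≡ F 0 + ∑ (p ∸ 1) (λ i → F (suc i))
  ∑-split-0 F = trans (cong (λ n → ∑ n F) (sym (suc-pred p))) (∑-head (pred p) F)

  suc<p : ∀ {i} → i < p ∸ 1 → suc i < p
  suc<p {i} i<p-1 = subst (suc (suc i) ≤_) (suc-pred p) (s≤s i<p-1)

  -- The coefficient at 0: only a = 0 reaches 0, p - 1 times.
  Tr-at-0 : ∀ f → Tr f 0 ≡ (p ∸ 1) * f 0
  Tr-at-0 f = begin
    Tr f 0                                                     ≡⟨ trans (Tr-coefficient f 0 (>-nonZero⁻¹ p)) (∑-split-0 _) ⟩
    hits 0 0 * f 0 + ∑ (p ∸ 1) (λ i → hits (suc i) 0 * f (suc i))
      ≡⟨ cong₂ _+_ (cong (_* f 0) hits-0-0) (∑-zero (p ∸ 1) _ (λ i i<p-1 → cong (_* f (suc i)) (hits-a-0 z<s (suc<p i<p-1)))) ⟩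
    (p ∸ 1) * f 0 + 0                                          ≡⟨ +-identityʳ _ ⟩
    (p ∸ 1) * f 0                                              ∎
    where open ≡-Reasoning

  -- The coefficient at j ≠ 0: each a ≠ 0 reaches j exactly once, a = 0 never.
  Tr-at-j : ∀ f {j} → 0 < j → j < p → Tr f j + f 0 ≡ S f
  Tr-at-j f {j} 0<j j<p = begin
    Tr f j + f 0
      ≡⟨ cong (_+ f 0) (trans (Tr-coefficient f j j<p) (∑-split-0 _)) ⟩
    hits 0 j * f 0 + ∑ (p ∸ 1) (λ i → hits (suc i) j * f (suc i)) + f 0
      ≡⟨ cong (λ x → x + f 0) (cong₂ _+_ (cong (_* f 0) (hits-0-j 0<j)) (∑-cong< (p ∸ 1) (λ i i<p-1 →
           trans (cong (_* f (suc i)) (hits-a-j z<s (suc<p i<p-1) 0<j j<p)) (*-identityˡ _)))) ⟩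
    ∑ (p ∸ 1) (λ i → f (suc i)) + f 0
      ≡⟨ trans (+-comm _ (f 0)) (sym (∑-split-0 f)) ⟩
    S f ∎
    where open ≡-Reasoning

  Tr-plus-const : ∀ f → S f ≡ 0 [mod q ] → Tr f ⊕ const (f 0) ≋ mono (p * f 0) 0
  Tr-plus-const f Sf≡0 zero    _   = cong (_% q) (begin
    Tr f 0 + f 0        ≡⟨ cong (_+ f 0) (Tr-at-0 f) ⟩
    (p ∸ 1) * f 0 + f 0 ≡⟨ +-comm _ (f 0) ⟩
    suc (p ∸ 1) * f 0   ≡⟨ cong (_* f 0) (suc-pred p) ⟩
    p * f 0             ≡⟨ +-identityʳ (p * f 0) ⟨
    p * f 0 + 0         ∎)
    where open ≡-Reasoning
  Tr-plus-const f Sf≡0 (suc k) k<p = trans (cong (_% q) (Tr-at-j f z<s k<p)) Sf≡0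

  open ZeroSumPattern q 3≤q using (zeroSum; ∑-zeroSum; zeroSum-range)

  -- The first p entries of the zero-sum pattern sum to a multiple of q (p is odd).
  S-zeroSum : S zeroSum ≡ 0 [mod q ]
  S-zeroSum with p≡3+2m
  ... | m , p≡3+2m = ∣⇒mod0 (subst (q ∣_) (trans (sym (∑-zeroSum m)) (cong (λ n → ∑ n zeroSum) (sym p≡3+2m)))
                                    (m∣m*n (suc m)))

  -- Let f = W X₀ with f₀ ≢ 0 and S f ≡ 0.  The trace of f is a
  -- multiple W ⊛ ∑ Yₘ of W, and multiplying it by the zero-sum vector t gives
  -- (Tr f + f₀ (1 + … + x^(p-1))) ⊛ t = p f₀ · t, which has no zero coefficient.
  multiple-via-trace : ∀ W X₀ → ¬ ((W ⊛ X₀) 0 ≡ 0 [mod q ]) → S (W ⊛ X₀) ≡ 0 [mod q ] →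
                       ∃ λ X → NowhereZero (W ⊛ X)
  multiple-via-trace W X₀ f₀≢0 Sf≡0 = ∑R (p ∸ 1) Y ⊛ zeroSum , nowhereZero
    where
    open MultiplesOf W X₀
    f : R
    f = W ⊛ X₀
    c : ℕ
    c = p * f 0

    W⊛∑Y≋Tr : W ⊛ ∑R (p ∸ 1) Y ≋ Tr f
    W⊛∑Y≋Tr = ≋-trans (≈⇒≋ (⊛-∑R W (p ∸ 1) Y)) (λ k k<p → ∑-mod (p ∸ 1) (λ m _ → sym (φ^-multiple m k k<p)))

    Tr⊛t : ∀ k → k < p → (Tr f ⊛ zeroSum) k ≡ zeroSum k * c [mod q ]
    Tr⊛t k k<p = begin
      (Tr f ⊛ zeroSum) k % q                           ≡⟨ cong (_% q) (+-identityʳ _) ⟨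
      ((Tr f ⊛ zeroSum) k + 0) % q                     ≡⟨ +-mod {a = (Tr f ⊛ zeroSum) k} refl (sym const⊛t≡0) ⟩
      ((Tr f ⊛ zeroSum) k + (const (f 0) ⊛ zeroSum) k) % q ≡⟨ cong (_% q) (⊛-distribʳ zeroSum (Tr f) (const (f 0)) k k<p) ⟨
      ((Tr f ⊕ const (f 0)) ⊛ zeroSum) k % q           ≡⟨ ⊛-≋ (Tr-plus-const f Sf≡0) (λ _ _ → refl) k k<p ⟩
      (mono c 0 ⊛ zeroSum) k % q                       ≡⟨ cong (_% q) (trans (⊛-comm (mono c 0) zeroSum k k<p) (⊛-mono zeroSum c 0 k (>-nonZero⁻¹ p) k<p)) ⟩
      (zeroSum (k ⊖ 0) * c) % q                        ≡⟨ cong (λ i → (zeroSum i * c) % q) (k⊖0≡k k<p) ⟩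
      (zeroSum k * c) % q                              ∎
      where
      open ≡-Reasoning
      const⊛t≡0 : (const (f 0) ⊛ zeroSum) k ≡ 0 [mod q ]
      const⊛t≡0 = trans (cong (_% q) (const-⊛ (f 0) zeroSum k k<p))
                        (trans (*-mod {a = f 0} refl S-zeroSum) (cong (_% q) (*-zeroʳ (f 0))))

    tₖc≢0 : ∀ k → ¬ (zeroSum k * c ≡ 0 [mod q ])
    tₖc≢0 k tₖc≡0 with euclidsLemma (zeroSum k) c pq (mod0⇒∣ tₖc≡0)
    ... | inj₁ q∣tₖ = <⇒≱ (proj₂ (zeroSum-range k)) (∣⇒≤ {{>-nonZero (proj₁ (zeroSum-range k))}} q∣tₖ)
    ... | inj₂ q∣c with euclidsLemma p (f 0) pq q∣c
    ...   | inj₁ q∣p  = q∤p q∣p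
    ...   | inj₂ q∣f₀ = f₀≢0 (∣⇒mod0 q∣f₀)

    nowhereZero : NowhereZero (W ⊛ (∑R (p ∸ 1) Y ⊛ zeroSum))
    nowhereZero k k<p W⊛X≡0 = tₖc≢0 k (begin
      (zeroSum k * c) % q                          ≡⟨ Tr⊛t k k<p ⟨
      (Tr f ⊛ zeroSum) k % q                       ≡⟨ ⊛-≋ W⊛∑Y≋Tr (λ _ _ → refl) k k<p ⟨
      ((W ⊛ ∑R (p ∸ 1) Y) ⊛ zeroSum) k % q         ≡⟨ cong (_% q) (ℕ[ℤ/p].*-assoc W (∑R (p ∸ 1) Y) zeroSum k k<p) ⟩
      (W ⊛ (∑R (p ∸ 1) Y ⊛ zeroSum)) k % q         ≡⟨ W⊛X≡0 ⟩
      0 % q                                        ∎)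
      where open ≡-Reasoning

  -- 1 - x, written with natural coefficients as 1 + (q - 1) x.
  1-x : R
  1-x = 1R ⊕ mono (q ∸ 1) 1

  1<p : 1 < p
  1<p = prime≥2 pp

  S-1-x : S 1-x ≡ q
  S-1-x = trans (S-⊕ 1R (mono (q ∸ 1) 1))
                (trans (cong₂ _+_ S-1R (S-mono (q ∸ 1) 1 1<p)) (m+[n∸m]≡n (≤-trans (s≤s z≤n) (prime≥2 pq))))

  annihilated⇒constant : ∀ W → (∀ k → k < p → (W ⊛ 1-x) k ≡ 0 [mod q ]) → ∀ k → k < p → W k ≡ W 0 [mod q ]
  annihilated⇒constant W W[1-x]≡0 zero    _     = refl
  annihilated⇒constant W W[1-x]≡0 (suc k) 1+k<p =
    trans (x+[m-1]y≡0⇒x≡y (trans (cong (_% q) (sym coefficient)) (W[1-x]≡0 (suc k) 1+k<p)))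
          (annihilated⇒constant W W[1-x]≡0 k (<-trans (n<1+n k) 1+k<p))
    where
    1+k⊖1≡k : suc k ⊖ 1 ≡ k
    1+k⊖1≡k = trans (cong (_% p) (trans (sym (+-suc k (p ∸ 1))) (cong (k +_) (suc-pred p))))
                    (trans ([m+n]%n≡m%n k p) (m<n⇒m%n≡m (<-trans (n<1+n k) 1+k<p)))
    coefficient : (W ⊛ 1-x) (suc k) ≡ W (suc k) + W k * (q ∸ 1)
    coefficient = trans (ℕ[ℤ/p].distribˡ W 1R (mono (q ∸ 1) 1) (suc k) 1+k<p)
      (cong₂ _+_ (ℕ[ℤ/p].*-identityʳ W (suc k) 1+k<p)
                 (trans (⊛-mono W (q ∸ 1) 1 (suc k) 1<p 1+k<p) (cong (λ i → W i * (q ∸ 1)) 1+k⊖1≡k)))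

  -- Either some coefficient hₖ₀ of h = W (1 - x) is nonzero, and the trace trick
  -- applies to f = h xʳ (with r = -k₀, so f₀ = hₖ₀ and S f = S W · q ≡ 0);
  -- or W is a nonzero constant and X = 1 already works.
  nowhereZeroMultiple : ∀ W → (∃ λ a → a < p × ¬ (W a ≡ 0 [mod q ])) → ∃ λ X → NowhereZero (W ⊛ X)
  nowhereZeroMultiple W (a , a<p , Wa≢0) with anyUpTo? (λ k → ¬? ((W ⊛ 1-x) k % q ≟ 0 % q)) p
  ... | yes (k₀ , k₀<p , hk₀≢0) = multiple-via-trace W (1-x ⊛ mono 1 r) f₀≢0 Sf≡0
    where
    r : ℕ
    r = 0 ⊖ k₀
    r<p : r < p
    r<p = ⊖-<p 0 k₀
    f₀≡hk₀ : (W ⊛ (1-x ⊛ mono 1 r)) 0 ≡ (W ⊛ 1-x) k₀ * 1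
    f₀≡hk₀ = begin
      (W ⊛ (1-x ⊛ mono 1 r)) 0 ≡⟨ ℕ[ℤ/p].*-assoc W 1-x (mono 1 r) 0 (>-nonZero⁻¹ p) ⟨
      ((W ⊛ 1-x) ⊛ mono 1 r) 0 ≡⟨ ⊛-mono (W ⊛ 1-x) 1 r 0 r<p (>-nonZero⁻¹ p) ⟩
      (W ⊛ 1-x) (0 ⊖ r) * 1    ≡⟨ cong (λ i → (W ⊛ 1-x) i * 1) (trans (⊖-flip k₀ 0 k₀<p (>-nonZero⁻¹ p)) (k⊖0≡k k₀<p)) ⟩
      (W ⊛ 1-x) k₀ * 1         ∎
      where open ≡-Reasoning
    f₀≢0 : ¬ ((W ⊛ (1-x ⊛ mono 1 r)) 0 ≡ 0 [mod q ])
    f₀≢0 f₀≡0 = hk₀≢0 (trans (cong (_% q) (trans (sym (*-identityʳ _)) (sym f₀≡hk₀))) f₀≡0)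
    Sf≡0 : S (W ⊛ (1-x ⊛ mono 1 r)) ≡ 0 [mod q ]
    Sf≡0 = ∣⇒mod0 (subst (q ∣_) (sym Sf≡SW*q) (∣n⇒∣m*n (S W) (∣m⇒∣m*n 1 (∣-refl {q}))))
      where
      Sf≡SW*q : S (W ⊛ (1-x ⊛ mono 1 r)) ≡ S W * (q * 1)
      Sf≡SW*q = trans (S-⊛ W _) (cong (S W *_) (trans (S-⊛ 1-x (mono 1 r)) (cong₂ _*_ S-1-x (S-mono 1 r r<p))))
  ... | no none = 1R , λ k k<p W⊛1≡0 → Wa≢0 (begin
    W a % q          ≡⟨ constant a a<p ⟩
    W 0 % q          ≡⟨ constant k k<p ⟨
    W k % q          ≡⟨ cong (_% q) (ℕ[ℤ/p].*-identityʳ W k k<p) ⟨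
    (W ⊛ 1R) k % q   ≡⟨ W⊛1≡0 ⟩
    0 % q            ∎)
    where
    open ≡-Reasoning
    annihilated : ∀ k → k < p → (W ⊛ 1-x) k ≡ 0 [mod q ]
    annihilated k k<p with (W ⊛ 1-x) k % q ≟ 0 % q
    ... | yes hₖ≡0 = hₖ≡0
    ... | no  hₖ≢0 = ⊥-elim (none (k , k<p , hₖ≢0))
    constant : ∀ k → k < p → W k ≡ W 0 [mod q ]
    constant = annihilated⇒constant W annihilated

module Coordinates (q : ℕ) .{{_ : NonZero q}} where
  open import Data.Fin using (Fin; toℕ; fromℕ<)
  open import Data.Fin.Properties using (toℕ-fromℕ<; toℕ<n; toℕ-injective)
  open import Data.Vec using (Vec; []; _∷_; init; last; sum; zipWith; tabulate)

  -- coord x i is the i-th coordinate of x (and 0 beyond its length)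
  coord : ∀ {n} → Vec (Fin q) n → ℕ → ℕ
  coord []       i       = 0
  coord (x ∷ xs) zero    = toℕ x
  coord (x ∷ xs) (suc i) = coord xs i

  coord<q : ∀ {n} (v : Vec (Fin q) n) i → coord v i < q
  coord<q []      i       = >-nonZero⁻¹ q
  coord<q (x ∷ v) zero    = toℕ<n x
  coord<q (x ∷ v) (suc i) = coord<q v i

  coord-injective : ∀ {n} (a b : Vec (Fin q) n) → (∀ i → i < n → coord a i ≡ coord b i) → a ≡ b
  coord-injective []      []      _     = refl
  coord-injective (x ∷ a) (y ∷ b) a≗b =
    cong₂ _∷_ (toℕ-injective (a≗b 0 z<s)) (coord-injective a b (λ i i<n → a≗b (suc i) (s≤s i<n)))

  toℕ-0F : toℕ (0F q) ≡ 0
  toℕ-0F = trans (toℕ-fromℕ< _) 0%m≡0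

  zero-or-nonzeroCoord : ∀ {n} (v : Vec (Fin q) n) → v ≡ zeroV q ⊎ ∃ λ i → i < n × coord v i ≢ 0
  zero-or-nonzeroCoord []      = inj₁ refl
  zero-or-nonzeroCoord (x ∷ v) with toℕ x ≟ 0
  ... | no  x≢0 = inj₂ (0 , z<s , x≢0)
  ... | yes x≡0 with zero-or-nonzeroCoord v
  ...   | inj₁ refl               = inj₁ (cong (_∷ zeroV q) (toℕ-injective (trans x≡0 (sym toℕ-0F))))
  ...   | inj₂ (i , i<n , vᵢ≢0)   = inj₂ (suc i , s≤s i<n , vᵢ≢0)

  Fq-ext : ∀ {a b : Fq q} → toℕ a ≡ toℕ b [mod q ] → a ≡ b
  Fq-ext {a} {b} a≡b = toℕ-injective (trans (sym (m<n⇒m%n≡m (toℕ<n a))) (trans a≡b (m<n⇒m%n≡m (toℕ<n b))))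

  toℕ-mod : ∀ n → toℕ (n mod q) ≡ n [mod q ]
  toℕ-mod n = trans (cong (_% q) (toℕ-fromℕ< _)) (%-mod n)

  toℕ-+F : ∀ a b → toℕ (_+F_ q a b) ≡ toℕ a + toℕ b [mod q ]
  toℕ-+F a b = toℕ-mod (toℕ a + toℕ b)

  toℕ-*F : ∀ a b → toℕ (_*F_ q a b) ≡ toℕ a * toℕ b [mod q ]
  toℕ-*F a b = toℕ-mod (toℕ a * toℕ b)

  coord-ext : ∀ {n} (a b : Vec (Fin q) n) → (∀ i → i < n → coord a i ≡ coord b i [mod q ]) → a ≡ b
  coord-ext a b a≡b = coord-injective a b (λ i i<n →
    trans (sym (m<n⇒m%n≡m (coord<q a i))) (trans (a≡b i i<n) (m<n⇒m%n≡m (coord<q b i))))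

  coord-+V : ∀ {n} (u w : Vecq q n) i → coord (_+V_ q u w) i ≡ coord u i + coord w i [mod q ]
  coord-+V []      []      i       = refl
  coord-+V (a ∷ u) (b ∷ w) zero    = toℕ-+F a b
  coord-+V (a ∷ u) (b ∷ w) (suc i) = coord-+V u w i

  coord-·V : ∀ {n} c (u : Vecq q n) i → coord (_·V_ q c u) i ≡ toℕ c * coord u i [mod q ]
  coord-·V c []      i       = cong (_% q) (sym (*-zeroʳ (toℕ c)))
  coord-·V c (a ∷ u) zero    = toℕ-*F c a
  coord-·V c (a ∷ u) (suc i) = coord-·V c u i

  fromCoords : ∀ {n} → (ℕ → ℕ) → Vec (Fin q) n
  fromCoords X = tabulate (λ i → X (toℕ i) mod q)

  coord-fromCoords : ∀ {n} (X : ℕ → ℕ) i → i < n → coord (fromCoords {n} X) i ≡ X i % q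
  coord-fromCoords {suc n} X zero    _         = toℕ-fromℕ< _
  coord-fromCoords {suc n} X (suc i) (s≤s i<n) = coord-fromCoords {n} (X ∘ suc) i i<n

  -- The cyclic shift moves coordinate j - 1 to j, i.e. reads at index j + (n - 1).
  coord-σ : ∀ {m} (xs : Vec (Fin q) (suc m)) j → j < suc m → coord (σ xs) j ≡ coord xs ((j + m) % suc m)
  coord-σ {m} xs zero _ = trans (coord-last xs) (cong (coord xs) (sym (m≤n⇒m%n≡m ≤-refl)))
    where
    coord-last : ∀ {m} (xs : Vec (Fin q) (suc m)) → toℕ (last xs) ≡ coord xs m
    coord-last {zero}  (x ∷ [])     = refl
    coord-last {suc m} (x ∷ y ∷ ys) = coord-last (y ∷ ys)
  coord-σ {m} xs (suc i) (s≤s i<m) = trans (coord-init xs i i<m) (cong (coord xs) (sym (begin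
    (suc i + m) % suc m  ≡⟨ cong (_% suc m) (+-suc i m) ⟨
    (i + suc m) % suc m  ≡⟨ [m+n]%n≡m%n i (suc m) ⟩
    i % suc m            ≡⟨ m<n⇒m%n≡m (≤-trans i<m (n≤1+n m)) ⟩
    i                    ∎)))
    where
    open ≡-Reasoning
    coord-init : ∀ {m} (xs : Vec (Fin q) (suc m)) i → i < m → coord (init xs) i ≡ coord xs i
    coord-init {suc m} (x ∷ y ∷ ys) zero    _         = refl
    coord-init {suc m} (x ∷ y ∷ ys) (suc i) (s≤s i<m) = coord-init (y ∷ ys) i i<m

  coord-σ^ : ∀ {n} .{{_ : NonZero n}} k (xs : Vec (Fin q) n) j → j < n →
             coord (σ^ k xs) j ≡ coord xs ((j + k * (n ∸ 1)) % n)
  coord-σ^ {suc m} zero    xs j j<n = cong (coord xs) (sym (trans (cong (_% suc m) (+-identityʳ j)) (m<n⇒m%n≡m j<n)))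
  coord-σ^ {suc m} (suc k) xs j j<n = begin
    coord (σ (σ^ k xs)) j                              ≡⟨ coord-σ (σ^ k xs) j j<n ⟩
    coord (σ^ k xs) ((j + m) % suc m)                  ≡⟨ coord-σ^ k xs ((j + m) % suc m) (m%n<n (j + m) (suc m)) ⟩
    coord xs (((j + m) % suc m + k * m) % suc m)       ≡⟨ cong (coord xs) (%-absorbˡ {m = suc m} (j + m) (k * m)) ⟩
    coord xs ((j + m + k * m) % suc m)                 ≡⟨ cong (λ i → coord xs (i % suc m)) (+-assoc j m (k * m)) ⟩
    coord xs ((j + (m + k * m)) % suc m)               ∎
    where open ≡-Reasoning

  σ^n≡id : ∀ {n} .{{_ : NonZero n}} (u : Vec (Fin q) n) → σ^ n u ≡ u
  σ^n≡id {n} u = coord-injective (σ^ n u) u (λ j j<n → trans (coord-σ^ n u j j<n) (cong (coord u) (begin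
    (j + n * (n ∸ 1)) % n  ≡⟨ cong (λ z → (j + z) % n) (*-comm n (n ∸ 1)) ⟩
    (j + (n ∸ 1) * n) % n  ≡⟨ [m+kn]%n≡m%n j (n ∸ 1) n ⟩
    j % n                  ≡⟨ m<n⇒m%n≡m j<n ⟩
    j                      ∎)))
    where open ≡-Reasoning

  σ^-+ : ∀ {A : Set} {n} a b (x : Vec A n) → σ^ a (σ^ b x) ≡ σ^ (a + b) x
  σ^-+ zero    b x = refl
  σ^-+ (suc a) b x = cong σ (σ^-+ a b x)

  toℕ-dot : ∀ {n} (v y : Vec (Fin q) n) → toℕ (dot q v y) ≡ ∑ n (λ i → coord v i * coord y i) % q
  toℕ-dot v y = trans (toℕ-fromℕ< _) (cong (_% q) (sum-coords v y))
    where
    sum-coords : ∀ {n} (v y : Vec (Fin q) n) → sum (zipWith (λ a b → toℕ a * toℕ b) v y) ≡ ∑ n (λ i → coord v i * coord y i)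
    sum-coords []      []      = refl
    sum-coords {suc n} (a ∷ v) (b ∷ y) =
      trans (cong (toℕ a * toℕ b +_) (sum-coords v y)) (sym (∑-head n (λ i → coord (a ∷ v) i * coord (b ∷ y) i)))

  toℕ-dot-mod : ∀ {n} (v y : Vec (Fin q) n) → toℕ (dot q v y) ≡ ∑ n (λ i → coord v i * coord y i) [mod q ]
  toℕ-dot-mod v y = trans (cong (_% q) (toℕ-dot v y)) (%-mod _)

  dot-linear : ∀ {n} (v u w : Vecq q n) c →
               toℕ (dot q v (_+V_ q u (_·V_ q c w))) ≡ toℕ (dot q v u) + toℕ c * toℕ (dot q v w) [mod q ]
  dot-linear {n} v u w c = begin
    toℕ (dot q v (_+V_ q u (_·V_ q c w))) % q
      ≡⟨ toℕ-dot-mod v _ ⟩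
    ∑ n (λ i → coord v i * coord (_+V_ q u (_·V_ q c w)) i) % q
      ≡⟨ ∑-mod n (λ i _ → *-mod {a = coord v i} refl (trans (coord-+V u _ i) (+-mod {a = coord u i} refl (coord-·V c w i)))) ⟩
    ∑ n (λ i → coord v i * (coord u i + toℕ c * coord w i)) % q
      ≡⟨ cong (_% q) (trans (∑-cong n (λ i → expand (coord v i) (coord u i) (toℕ c) (coord w i)))
                             (trans (∑-+ n _ _) (cong (∑ n (λ i → coord v i * coord u i) +_) (sym (∑-*ˡ n (toℕ c) _))))) ⟩
    (∑ n (λ i → coord v i * coord u i) + toℕ c * ∑ n (λ i → coord v i * coord w i)) % q
      ≡⟨ +-mod (sym (toℕ-dot-mod v u)) (*-mod {a = toℕ c} refl (sym (toℕ-dot-mod v w))) ⟩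
    (toℕ (dot q v u) + toℕ c * toℕ (dot q v w)) % q ∎
    where
    open ≡-Reasoning
    expand : ∀ v u c w → v * (u + c * w) ≡ v * u + c * (v * w)
    expand = solve-∀

  coord-zeroV : ∀ {n} i → coord (zeroV q {n}) i ≡ 0
  coord-zeroV {zero}  i       = refl
  coord-zeroV {suc n} zero    = toℕ-0F
  coord-zeroV {suc n} (suc i) = coord-zeroV {n} i

  dot-zeroV : ∀ {n} (u : Vecq q n) → toℕ (dot q (zeroV q) u) ≡ 0 [mod q ]
  dot-zeroV {n} u = trans (toℕ-dot-mod (zeroV q) u)
    (cong (_% q) (∑-zero n _ (λ i _ → cong (_* coord u i) (coord-zeroV {n} i))))

  dot-∷ : ∀ {n} a b (v u : Vecq q n) → toℕ (dot q (a ∷ v) (b ∷ u)) ≡ toℕ a * toℕ b + toℕ (dot q v u) [mod q ]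
  dot-∷ {n} a b v u = begin
    toℕ (dot q (a ∷ v) (b ∷ u)) % q                            ≡⟨ toℕ-dot-mod (a ∷ v) (b ∷ u) ⟩
    ∑ (suc n) (λ i → coord (a ∷ v) i * coord (b ∷ u) i) % q     ≡⟨ cong (_% q) (∑-head n _) ⟩
    (toℕ a * toℕ b + ∑ n (λ i → coord v i * coord u i)) % q     ≡⟨ +-mod {a = toℕ a * toℕ b} refl (sym (toℕ-dot-mod v u)) ⟩
    (toℕ a * toℕ b + toℕ (dot q v u)) % q                       ∎
    where open ≡-Reasoning

module NonzeroVectorsFail (p q : ℕ) .{{_ : NonZero p}} .{{_ : NonZero q}}
         (pp : Prime p) (pq : Prime q) (2∤q : ¬ 2 ∣ q) (q<p : q < p) (prim : PrimitiveRootMod p q) where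
  open import Data.Fin using (toℕ)
  open GroupRing p
  open Coordinates q
  open NowhereZeroMultiple p q pp pq 2∤q q<p prim using (nowhereZeroMultiple)

  -- v · σᵏ x is, modulo q, the coefficient of reverse v ⊛ x at -k ≡ k (p - 1).
  dot-σ^ : ∀ (v : Vecq q p) X k →
           toℕ (dot q v (σ^ k (fromCoords X))) ≡ (reverse (coord v) ⊛ X) ((k * (p ∸ 1)) % p) % q
  dot-σ^ v X k = begin
    toℕ (dot q v (σ^ k x))                         ≡⟨ toℕ-dot v (σ^ k x) ⟩
    ∑ p (λ i → coord v i * coord (σ^ k x) i) % q    ≡⟨ cong (_% q) (∑-cong< p (λ i i<p → cong (coord v i *_) (shifted i i<p))) ⟩
    ∑ p (λ i → coord v i * (X ((i + c) % p) % q)) % q ≡⟨ ∑-mod p (λ i _ → *-mod {a = coord v i} refl (%-mod (X ((i + c) % p)))) ⟩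
    ∑ p (λ i → coord v i * X ((i + c) % p)) % q     ≡⟨ cong (_% q) (correlation (coord v) X c (m%n<n _ p)) ⟩
    (reverse (coord v) ⊛ X) c % q                   ∎
    where
    open ≡-Reasoning
    x : Vecq q p
    x = fromCoords {p} X
    c : ℕ
    c = (k * (p ∸ 1)) % p
    shifted : ∀ i → i < p → coord (σ^ k x) i ≡ X ((i + c) % p) % q
    shifted i i<p = trans (coord-σ^ k x i i<p)
      (trans (cong (coord x) (sym (%-absorbʳ {m = p} i (k * (p ∸ 1))))) (coord-fromCoords X _ (m%n<n _ p)))

  -- Take a nonzero coordinate vᵢ₀ of v: the reversed vector W is nonzero at
  -- -i₀, so it has a nowhere-zero multiple W ⊛ X, and x = fromCoords X has
  -- v · σᵏ x ≠ 0 for every k by `dot-σ^`.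
  separating : ∀ (v : Vecq q p) → v ≢ zeroV q → ∃ λ x → ∀ k → dot q v (σ^ k x) ≢ 0F q
  separating v v≢0 with zero-or-nonzeroCoord v
  ... | inj₁ v≡0 = ⊥-elim (v≢0 v≡0)
  ... | inj₂ (i₀ , i₀<p , vᵢ₀≢0) with nowhereZeroMultiple (reverse (coord v)) (0 ⊖ i₀ , ⊖-<p 0 i₀ , W≢0)
    where
    W≢0 : ¬ (reverse (coord v) (0 ⊖ i₀) ≡ 0 [mod q ])
    W≢0 Wᵢ≡0 = vᵢ₀≢0 (begin
      coord v i₀                     ≡⟨ m<n⇒m%n≡m (coord<q v i₀) ⟨
      coord v i₀ % q                 ≡⟨ cong (λ i → coord v i % q) (trans (⊖-flip i₀ 0 i₀<p (>-nonZero⁻¹ p)) (k⊖0≡k i₀<p)) ⟨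
      reverse (coord v) (0 ⊖ i₀) % q ≡⟨ Wᵢ≡0 ⟩
      0 % q                          ≡⟨ 0%m≡0 ⟩
      0                              ∎)
      where open ≡-Reasoning
  ...   | X , nowhereZero = fromCoords X , λ k v·σᵏx≡0 →
    nowhereZero ((k * (p ∸ 1)) % p) (m%n<n _ p)
      (trans (sym (dot-σ^ v X k)) (trans (cong toℕ v·σᵏx≡0) (trans toℕ-0F (sym 0%m≡0))))

-- Proof by induction on the length,
-- by Gaussian elimination of the first coordinate: a pivot (1, w₁) ∈ U exists,
-- and the slice {w | (0, w) ∈ U} again separates, so it is everything.
module LinearAlgebra (q : ℕ) .{{_ : NonZero q}} (pq : Prime q) where
  open import Data.Fin using (toℕ)
  open import Data.Fin.Properties using (toℕ-fromℕ<; toℕ<n)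
  open import Data.Vec using ([]; _∷_)
  open Coordinates q

  1F : Fq q
  1F = 1 mod q

  toℕ-1F : toℕ 1F ≡ 1
  toℕ-1F = trans (toℕ-fromℕ< _) (m<n⇒m%n≡m (prime≥2 pq))

  -F_ : Fq q → Fq q
  -F a = (q ∸ toℕ a) mod q

  -F-inverse : ∀ a → toℕ a + toℕ (-F a) ≡ 0 [mod q ]
  -F-inverse a = begin
    (toℕ a + toℕ (-F a)) % q  ≡⟨ +-mod {a = toℕ a} refl (toℕ-mod (q ∸ toℕ a)) ⟩
    (toℕ a + (q ∸ toℕ a)) % q ≡⟨ cong (_% q) (m+[n∸m]≡n (<⇒≤ (toℕ<n a))) ⟩
    q % q                     ≡⟨ trans (n%n≡0 q) (sym 0%m≡0) ⟩
    0 % q                     ∎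
    where open ≡-Reasoning

  -- multiplicative inverse a^(q-2), by Fermat's little theorem
  inv : Fq q → Fq q
  inv a = (toℕ a ^ (q ∸ 2)) mod q

  inv-inverse : ∀ a → toℕ a ≢ 0 → _*F_ q (inv a) a ≡ 1F
  inv-inverse a a≢0 = Fq-ext (begin
    toℕ (_*F_ q (inv a) a) % q       ≡⟨ trans (toℕ-*F (inv a) a) (*-mod (toℕ-mod (x ^ (q ∸ 2))) refl) ⟩
    (x ^ (q ∸ 2) * x) % q            ≡⟨ cong (_% q) (x^[q-2]*x q (prime≥2 pq)) ⟩
    (x ^ (q ∸ 1)) % q                ≡⟨ cancel-mod-prime pq q∤x (m^n>0 x {{≢-nonZero a≢0}} (q ∸ 1)) x*x^[q-1]≡x ⟩
    1 % q                            ≡⟨ cong (_% q) toℕ-1F ⟨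
    toℕ 1F % q                       ∎)
    where
    open ≡-Reasoning
    x : ℕ
    x = toℕ a
    q∤x : ¬ q ∣ x
    q∤x q∣x = a≢0 (trans (sym (m<n⇒m%n≡m (toℕ<n a))) (n∣m⇒m%n≡0 x q q∣x))
    x^[q-2]*x : ∀ n → 2 ≤ n → x ^ (n ∸ 2) * x ≡ x ^ (n ∸ 1)
    x^[q-2]*x 1             (s≤s ())
    x^[q-2]*x (suc (suc n)) _ = *-comm (x ^ n) x
    x*x^[q-1]≡x : x * x ^ (q ∸ 1) ≡ x [mod q ]
    x*x^[q-1]≡x = trans (cong (λ e → (x ^ e) % q) (suc-pred q)) (fermat pq x)

  Separating : ∀ {n} → (Vecq q n → Set) → Set
  Separating U = ∀ v → v ≢ zeroV q → ∃ λ u → U u × dot q v u ≢ 0F q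

  module Elimination {n} (U : Vecq q (suc n) → Set) (U-subspace : IsSubspace q U) where
    open IsSubspace U-subspace

    -- Some u ∈ U has a nonzero first coordinate; scaling it gives a pivot (1, w₁).
    pivot : Separating U → ∃ λ w₁ → U (1F ∷ w₁)
    pivot separates with separates (1F ∷ zeroV q) (λ e₀≡0 → 1≢0 (cong (λ { (a ∷ _) → toℕ a }) e₀≡0))
      where
      1≢0 : toℕ 1F ≢ toℕ (0F q)
      1≢0 1≡0 = 1≢0′ (trans (sym toℕ-1F) (trans 1≡0 toℕ-0F))
        where
        1≢0′ : 1 ≢ 0
        1≢0′ ()
    ... | u₀ ∷ u′ , U-u , e₀·u≢0 = _·V_ q (inv u₀) u′ , subst (λ a → U (a ∷ _·V_ q (inv u₀) u′)) (inv-inverse u₀ u₀≢0) (·∈ (inv u₀) U-u)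
      where
      u₀≢0 : toℕ u₀ ≢ 0
      u₀≢0 u₀≡0 = e₀·u≢0 (Fq-ext (begin
        toℕ (dot q (1F ∷ zeroV q) (u₀ ∷ u′)) % q     ≡⟨ dot-∷ 1F u₀ (zeroV q) u′ ⟩
        (toℕ 1F * toℕ u₀ + toℕ (dot q (zeroV q) u′)) % q ≡⟨ +-mod (cong (λ x → (toℕ 1F * x) % q) u₀≡0) (dot-zeroV u′) ⟩
        (toℕ 1F * 0 + 0) % q                         ≡⟨ cong (λ x → (x + 0) % q) (*-zeroʳ (toℕ 1F)) ⟩
        0 % q                                        ≡⟨ cong (_% q) toℕ-0F ⟨
        toℕ (0F q) % q                               ∎))
        where open ≡-Reasoning

    Slice : Vecq q n → Set
    Slice w = U (0F q ∷ w)

    slice-subspace : IsSubspace q Slice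
    slice-subspace = record
      { zero∈ = zero∈
      ; +∈    = λ {a} {b} Ua Ub → subst (λ h → U (h ∷ _+V_ q a b)) 0+0≡0 (+∈ Ua Ub)
      ; ·∈    = λ c {a} Ua → subst (λ h → U (h ∷ _·V_ q c a)) (c*0≡0 c) (·∈ c Ua) }
      where
      0+0≡0 : _+F_ q (0F q) (0F q) ≡ 0F q
      0+0≡0 = Fq-ext (trans (toℕ-+F (0F q) (0F q)) (cong (_% q) (trans (cong₂ _+_ toℕ-0F toℕ-0F) (sym toℕ-0F))))
      c*0≡0 : ∀ c → _*F_ q c (0F q) ≡ 0F q
      c*0≡0 c = Fq-ext (trans (toℕ-*F c (0F q)) (cong (_% q) (trans (cong (toℕ c *_) toℕ-0F) (trans (*-zeroʳ (toℕ c)) (sym toℕ-0F)))))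

    clear-head : ∀ {w₁ h u′} → U (1F ∷ w₁) → U (h ∷ u′) → Slice (_+V_ q u′ (_·V_ q (-F h) w₁))
    clear-head {w₁} {h} {u′} U-pivot U-u = subst (λ a → U (a ∷ _+V_ q u′ (_·V_ q (-F h) w₁))) h-h≡0 (+∈ U-u (·∈ (-F h) U-pivot))
      where
      h-h≡0 : _+F_ q h (_*F_ q (-F h) 1F) ≡ 0F q
      h-h≡0 = Fq-ext (begin
        toℕ (_+F_ q h (_*F_ q (-F h) 1F)) % q  ≡⟨ trans (toℕ-+F h _) (+-mod {a = toℕ h} refl (toℕ-*F (-F h) 1F)) ⟩
        (toℕ h + toℕ (-F h) * toℕ 1F) % q     ≡⟨ cong (λ x → (toℕ h + x) % q) (trans (cong (toℕ (-F h) *_) toℕ-1F) (*-identityʳ _)) ⟩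
        (toℕ h + toℕ (-F h)) % q              ≡⟨ -F-inverse h ⟩
        0 % q                                 ≡⟨ cong (_% q) toℕ-0F ⟨
        toℕ (0F q) % q                        ∎)
        where open ≡-Reasoning

    -- The slice separates: for v′ ≠ 0 use v = (-(v′ · w₁), v′); an element (h, u′)
    -- of U with v · (h, u′) ≠ 0 yields u′ - h w₁ in the slice, and
    -- v′ · (u′ - h w₁) = v · (h, u′).
    slice-separates : ∀ {w₁} → U (1F ∷ w₁) → Separating U → Separating Slice
    slice-separates {w₁} U-pivot separates v′ v′≢0
      with separates (-F (dot q v′ w₁) ∷ v′) (λ v≡0 → v′≢0 (cong (λ { (_ ∷ t) → t }) v≡0))
    ... | h ∷ u′ , U-u , v·u≢0 = _ , clear-head U-pivot U-u , λ v′·u″≡0 → v·u≢0 (Fq-ext (begin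
      toℕ (dot q (-F d ∷ v′) (h ∷ u′)) % q                     ≡⟨ dot-∷ (-F d) h v′ u′ ⟩
      (toℕ (-F d) * toℕ h + toℕ (dot q v′ u′)) % q             ≡⟨ cong (_% q) (+-comm _ (toℕ (dot q v′ u′))) ⟩
      (toℕ (dot q v′ u′) + toℕ (-F d) * toℕ h) % q             ≡⟨ +-mod {a = toℕ (dot q v′ u′)} refl negation-commutes ⟩
      (toℕ (dot q v′ u′) + toℕ (-F h) * toℕ d) % q             ≡⟨ dot-linear v′ u′ w₁ (-F h) ⟨
      toℕ (dot q v′ (_+V_ q u′ (_·V_ q (-F h) w₁))) % q        ≡⟨ cong (λ x → toℕ x % q) v′·u″≡0 ⟩
      toℕ (0F q) % q                                           ∎))
      where
      open ≡-Reasoning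
      d : Fq q
      d = dot q v′ w₁
      -- (-d) h ≡ -(d h) ≡ (-h) d
      negation-commutes : toℕ (-F d) * toℕ h ≡ toℕ (-F h) * toℕ d [mod q ]
      negation-commutes = inverse-unique {C = toℕ h * toℕ d}
        (trans (cong (_% q) (factor (toℕ (-F d)) (toℕ h) (toℕ d))) (trans (*-mod (trans (cong (_% q) (+-comm _ (toℕ d))) (-F-inverse d)) refl) (cong (_% q) refl)))
        (trans (cong (_% q) (factor′ (toℕ (-F h)) (toℕ h) (toℕ d))) (*-mod (trans (cong (_% q) (+-comm _ (toℕ h))) (-F-inverse h)) refl))
        where
        factor : ∀ a h d → a * h + h * d ≡ (a + d) * h
        factor = solve-∀
        factor′ : ∀ a h d → a * d + h * d ≡ (a + h) * d
        factor′ = solve-∀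

    reassemble : ∀ w₀ (w′ w₁ : Vecq q n) →
                 _+V_ q (0F q ∷ _+V_ q w′ (_·V_ q (-F w₀) w₁)) (_·V_ q w₀ (1F ∷ w₁)) ≡ w₀ ∷ w′
    reassemble w₀ w′ w₁ = cong₂ _∷_ head-eq (coord-ext _ w′ tail-eq)
      where
      open ≡-Reasoning
      head-eq : _+F_ q (0F q) (_*F_ q w₀ 1F) ≡ w₀
      head-eq = Fq-ext (begin
        toℕ (_+F_ q (0F q) (_*F_ q w₀ 1F)) % q ≡⟨ trans (toℕ-+F (0F q) _) (+-mod {a = toℕ (0F q)} refl (toℕ-*F w₀ 1F)) ⟩
        (toℕ (0F q) + toℕ w₀ * toℕ 1F) % q     ≡⟨ cong (_% q) (cong₂ _+_ toℕ-0F (trans (cong (toℕ w₀ *_) toℕ-1F) (*-identityʳ _))) ⟩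
        toℕ w₀ % q                              ∎)
      tail-eq : ∀ i → i < n → coord (_+V_ q (_+V_ q w′ (_·V_ q (-F w₀) w₁)) (_·V_ q w₀ w₁)) i ≡ coord w′ i [mod q ]
      tail-eq i _ = begin
        coord (_+V_ q (_+V_ q w′ (_·V_ q (-F w₀) w₁)) (_·V_ q w₀ w₁)) i % q
          ≡⟨ trans (coord-+V (_+V_ q w′ (_·V_ q (-F w₀) w₁)) (_·V_ q w₀ w₁) i)
                   (+-mod (trans (coord-+V w′ (_·V_ q (-F w₀) w₁) i) (+-mod {a = coord w′ i} refl (coord-·V (-F w₀) w₁ i)))
                                           (coord-·V w₀ w₁ i)) ⟩
        (coord w′ i + toℕ (-F w₀) * coord w₁ i + toℕ w₀ * coord w₁ i) % q
          ≡⟨ cong (_% q) (regroup (coord w′ i) (toℕ (-F w₀)) (toℕ w₀) (coord w₁ i)) ⟩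
        (coord w′ i + (toℕ w₀ + toℕ (-F w₀)) * coord w₁ i) % q
          ≡⟨ +-mod {a = coord w′ i} refl (*-mod (-F-inverse w₀) refl) ⟩
        (coord w′ i + 0) % q
          ≡⟨ cong (_% q) (+-identityʳ _) ⟩
        coord w′ i % q ∎
        where
        regroup : ∀ x a b y → x + a * y + b * y ≡ x + (b + a) * y
        regroup = solve-∀

  separating⇒full : ∀ n (U : Vecq q n → Set) → IsSubspace q U → Separating U → ∀ w → U w
  separating⇒full zero    U U-subspace _ [] = IsSubspace.zero∈ U-subspace
  separating⇒full (suc n) U U-subspace separates (w₀ ∷ w′) =
    subst U (reassemble w₀ w′ w₁) (+∈ slice-full (·∈ w₀ U-pivot))
    where
    open IsSubspace U-subspace
    open Elimination U U-subspace
    w₁ : Vecq q n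
    w₁ = proj₁ (pivot separates)
    U-pivot : U (1F ∷ w₁)
    U-pivot = proj₂ (pivot separates)
    slice-full : Slice (_+V_ q w′ (_·V_ q (-F w₀) w₁))
    slice-full = separating⇒full n Slice slice-subspace (slice-separates U-pivot separates) _

-- Theorem 6.5.  (2): a nonzero working v would contradict `separating`.
-- (1): if U is cyclically covering, the vector x given by `separating v` is
-- σᵏ u for some u ∈ U, and then v · u = v · σ^(p-k) x ≠ 0; so U separates
-- and is everything by linear algebra.
theorem6p5 : (q p : ℕ) → .{{_ : NonZero q}} → .{{_ : NonZero p}} →
    Prime q → ¬ (2 ∣ q) → Prime p → q < p → PrimitiveRootMod p q →
    ((U : Vecq q p → Set) → IsSubspace q U → CyclicallyCovering q U → (x : Vecq q p) → U x)
    × ((v : Vecq q p) → Works q v → v ≡ zeroV q)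
theorem6p5 q p pq 2∤q pp q<p prim = coveringIsFull , onlyZeroWorks
  where
  open import Data.Fin.Properties using () renaming (_≟_ to _≟F_)
  open import Data.Vec.Properties using (≡-dec)
  open NonzeroVectorsFail p q pp pq 2∤q q<p prim using (separating)
  open Coordinates q using (σ^-+; σ^n≡id)
  open LinearAlgebra q pq using (separating⇒full)

  onlyZeroWorks : (v : Vecq q p) → Works q v → v ≡ zeroV q
  onlyZeroWorks v works with ≡-dec _≟F_ v (zeroV q)
  ... | yes v≡0 = v≡0
  ... | no  v≢0 with separating v v≢0
  ...   | x , v·σᵏx≢0 with works x
  ...     | k , _ , v·σᵏx≡0 = ⊥-elim (v·σᵏx≢0 k v·σᵏx≡0)

  coveringIsFull : (U : Vecq q p → Set) → IsSubspace q U → CyclicallyCovering q U → (x : Vecq q p) → U x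
  coveringIsFull U U-subspace covers = separating⇒full p U U-subspace separates
    where
    separates : ∀ v → v ≢ zeroV q → ∃ λ u → U u × dot q v u ≢ 0F q
    separates v v≢0 with separating v v≢0
    ... | x , v·σᵏx≢0 with covers x
    ...   | k , k<p , u , U-u , σᵏu≡x = u , U-u , λ v·u≡0 → v·σᵏx≢0 (p ∸ k) (trans (cong (dot q v) σ^[p-k]x≡u) v·u≡0)
      where
      σ^[p-k]x≡u : σ^ (p ∸ k) x ≡ u
      σ^[p-k]x≡u = begin
        σ^ (p ∸ k) x          ≡⟨ cong (σ^ (p ∸ k)) σᵏu≡x ⟨
        σ^ (p ∸ k) (σ^ k u)   ≡⟨ σ^-+ (p ∸ k) k u ⟩
        σ^ (p ∸ k + k) u      ≡⟨ cong (λ n → σ^ n u) (m∸n+n≡m (<⇒≤ k<p)) ⟩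
        σ^ p u                ≡⟨ σ^n≡id u ⟩
        u                     ∎
        where open ≡-Reasoning
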